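{- Let $m$ and $n$ be positive integers such that $n\geq 2m-2$. A permutation $\pi\in S_n$ lies in the image $s^{n-m}(S_n)$ of the $(n-m)$-fold iterate of West's stack-sorting map if and only if $\operatorname{tl}(\pi)\geq n-m$ and every descent top of $\pi$ is a left-to-right maximum of $\pi$. Consequently, $|s^{n-m}(S_n)|=B_m$, the $m$-th Bell number.
   Context: A permutation is an ordering of a finite set of positive integers, written in one-line notation; $S_n$ is the set of permutations of $[n]=\{1,\ldots,n\}$. West's stack-sorting map $s$ is defined recursively: $s$ sends the empty permutation to itself, and for a nonempty permutation $\pi=LmR$ with $m$ its largest entry, $s(\pi)=s(L)\,s(R)\,m$. $s^t$ denotes the $t$-fold iterate. For $\pi=\pi_1\cdots\pi_n$, a descent is an index $i$ with $\pi_i>\pi_{i+1}$, and $\pi_i$ is then a descent top. A left-to-right maximum is an entry $\pi_j$ with $\pi_j>\pi_\ell$ for all $\ell<j$. The tail length $\operatorname{tl}(\pi)$ of $\pi\in S_n$ is the largest $\ell\in\{0,\ldots,n\}$ such that $\pi_i=i$ for all $i\in\{n-\ell+1,\ldots,n\}$. The Bell number $B_m$ is the number of set partitions of $[m]$. -}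

module Defs where

open import Data.Nat using (ℕ; zero; suc; _+_; _*_; _∸_; _<_; _≟_; _≡ᵇ_; _⊔_)
open import Data.Bool using (if_then_else_)
open import Data.List using (List; []; _∷_; _++_; map; upTo; span; foldr; length; reverse)
open import Data.Nat.ListAction using (sum)
open import Data.List.Relation.Unary.All using (All)
open import Data.List.Relation.Binary.Permutation.Propositional using (_↭_)
open import Data.List.Membership.Propositional using (_∈_)
open import Data.Product using (_×_; Σ; _,_)
open import Relation.Binary.PropositionalEquality using (_≡_)
open import Relation.Nullary using (¬?)

range : ℕ → List ℕ
range n = map suc (upTo n)

-- π ∈ S_n (one-line notation): π is a rearrangement of 1,…,n
IsPerm : ℕ → List ℕ → Set
IsPerm n π = π ↭ range n

-- largest entry of a list (0 for the empty list; entries are positive)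
maxL : List ℕ → ℕ
maxL = foldr _⊔_ 0

-- West's stack-sorting map: s(LmR) = s(L) s(R) m, m the largest entry.
-- Recursion is organised with fuel; fuel = length π always suffices,
-- since L and R are strictly shorter than LmR.
sFuel : ℕ → List ℕ → List ℕ
sFuel zero    π = π
sFuel (suc k) [] = []
sFuel (suc k) (x ∷ xs) with span (λ y → ¬? (y ≟ maxL (x ∷ xs))) (x ∷ xs)
... | L , []      = L   -- impossible: the maximum occurs in the list
... | L , m ∷ R   = sFuel k L ++ sFuel k R ++ (m ∷ [])

s : List ℕ → List ℕ
s π = sFuel (length π) π

iter : ℕ → (List ℕ → List ℕ) → List ℕ → List ℕ
iter zero    f x = x
iter (suc t) f x = f (iter t f x)

InImage : ℕ → ℕ → List ℕ → Set
InImage n t π = Σ (List ℕ) λ σ → IsPerm n σ × (iter t s σ ≡ π)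

-- tail length: largest ℓ with π_i = i for all i ∈ {n-ℓ+1,…,n}, n = length π
tlRev : ℕ → List ℕ → ℕ
tlRev k []       = 0
tlRev k (x ∷ xs) = if x ≡ᵇ k then suc (tlRev (k ∸ 1) xs) else 0

tl : List ℕ → ℕ
tl π = tlRev (length π) (reverse π)

IsDescentTop : List ℕ → ℕ → Set
IsDescentTop π x = Σ (List ℕ) λ L → Σ ℕ λ y → Σ (List ℕ) λ R →
  (π ≡ L ++ x ∷ y ∷ R) × (y < x)

IsLRMax : List ℕ → ℕ → Set
IsLRMax π x = Σ (List ℕ) λ L → Σ (List ℕ) λ R →
  (π ≡ L ++ x ∷ R) × All (_< x) L

stirling2 : ℕ → ℕ → ℕ
stirling2 zero    zero    = 1
stirling2 zero    (suc k) = 0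
stirling2 (suc n) zero    = 0
stirling2 (suc n) (suc k) = suc k * stirling2 n (suc k) + stirling2 n k

bell : ℕ → ℕ
bell m = sum (map (stirling2 m) (upTo (suc m)))

-- Write t = n − m. Since s moves the maximum to the end, s^t fixes the last t positions.
-- If a descent top b of π = s^t(σ) is not a left-to-right maximum, there is an obstruction
-- d … b a with a < b < d and only entries below b between b and a. Pulling an obstruction
-- back through one application of s yields an obstruction in the preimage and two new entries
-- larger than b that lie after a in π; after t steps π has 2t + 1 entries above b ≥ 2, so
-- n ≥ 2t + 3, which n ≥ 2m − 2 forbids.
-- Conversely, if every descent top is a left-to-right maximum, π splits into blocks
-- M₁A₁ M₂A₂ … with increasing maxima Mᵢ and increasing runs Aᵢ below them. Moving every run
-- one block to the right and appending the next value gives a preimage under s of the same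
-- kind, so such a π with t fixed points at the end lies in s^t(S_n). Block forms of [m] are
-- counted by the Stirling recurrence (1 forms its own block or joins one), hence by B_m.

module Submission where

open import Defs
open import Data.Bool using (true; false; T)
open import Data.Empty using (⊥-elim)
open import Data.List
  using (List; []; _∷_; _++_; [_]; length; map; reverse; upTo; span; filter; concatMap)
open import Data.List.Properties
  using (++-assoc; ++-identityʳ; ∷-injective; ∷ʳ-injectiveˡ; length-++; length-map; length-upTo;
         filter-++; filter-accept; filter-reject; map-++; map-∘; map-id; map-id-local; map-cong; map-injective;
         map-upTo; upTo-∷ʳ; reverse-++; reverse-involutive; unfold-reverse)
open import Data.List.Membership.Propositional using (_∈_; _∉_; find)
open import Data.List.Membership.Propositional.Properties
  using (∈-++⁺ˡ; ∈-++⁺ʳ; ∈-++⁻; ∈-map⁺; ∈-map⁻; ∈-upTo⁺; ∈-concatMap⁺; ∈-concatMap⁻)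
open import Data.List.Relation.Binary.Disjoint.Propositional using (Disjoint)
open import Data.List.Relation.Binary.Permutation.Propositional
  using (_↭_; ↭-refl; ↭-sym; ↭-trans; ↭⇒↭ₛ; prep; swap)
import Data.List.Relation.Binary.Permutation.Propositional.Properties as ↭
import Data.List.Relation.Binary.Permutation.Setoid.Properties as ↭ₛ
open import Data.List.Relation.Unary.All as All using (All; []; _∷_)
import Data.List.Relation.Unary.All.Properties as All
open import Data.List.Relation.Unary.All.Properties.Core using (¬All⇒Any¬)
open import Data.List.Relation.Unary.Any as Any using (Any; here; there)
open import Data.List.Relation.Unary.AllPairs as AllPairs using (AllPairs; []; _∷_)
import Data.List.Relation.Unary.AllPairs.Properties as AllPairs
open import Data.List.Relation.Unary.Unique.Propositional using (Unique)
import Data.List.Relation.Unary.Unique.Propositional.Properties as Unique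
open import Data.Nat
open import Data.Nat.ListAction using (sum)
open import Data.Nat.Properties
open import Data.List.Membership.DecPropositional _≟_ using (_∈?_)
open import Data.Product using (_×_; Σ; ∃; _,_; proj₁; proj₂)
open import Data.Product.Properties using (×-≡,≡←≡)
open import Data.Sum using (_⊎_; inj₁; inj₂)
open import Data.Unit using (⊤)
open import Function.Bundles using (_⇔_; mk⇔)
open import Relation.Binary.Definitions using (tri<; tri≈; tri>)
open import Relation.Binary.PropositionalEquality
  using (_≡_; _≢_; ≢-sym; refl; sym; trans; cong; cong₂; subst; subst₂; setoid; module ≡-Reasoning)
open import Relation.Nullary using (¬_; Dec; yes; no; ¬?)
open import Relation.Nullary.Decidable using (_×-dec_; _⊎-dec_)
open import Relation.Unary using (Decidable)

position : List ℕ → ℕ → ℕ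
position [] x = 0
position (h ∷ t) x with h ≟ x
... | yes _ = 0
... | no _ = suc (position t x)

position<length : ∀ {x} ℓ → x ∈ ℓ → position ℓ x < length ℓ
position<length {x} (h ∷ t) p with h ≟ x
... | yes _ = s≤s z≤n
position<length {x} (h ∷ t) (here refl) | no h≢x = ⊥-elim (h≢x refl)
position<length {x} (h ∷ t) (there p) | no _ = s≤s (position<length t p)

position-++ˡ : ∀ {x} A B → x ∈ A → position (A ++ B) x ≡ position A x
position-++ˡ {x} (h ∷ t) B p with h ≟ x
... | yes _ = refl
position-++ˡ {x} (h ∷ t) B (here refl) | no h≢x = ⊥-elim (h≢x refl)
position-++ˡ {x} (h ∷ t) B (there p) | no _ = cong suc (position-++ˡ t B p)

position-++ʳ : ∀ {x} A B → x ∉ A → position (A ++ B) x ≡ length A + position B x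
position-++ʳ [] B p = refl
position-++ʳ {x} (h ∷ t) B p with h ≟ x
... | yes refl = ⊥-elim (p (here refl))
... | no _ = cong suc (position-++ʳ t B (λ q → p (there q)))

position-injective : ∀ {x y} ℓ → x ∈ ℓ → y ∈ ℓ → position ℓ x ≡ position ℓ y → x ≡ y
position-injective {x} {y} (h ∷ t) px py e with h ≟ x | h ≟ y
... | yes refl | yes refl = refl
... | yes _ | no _ = ⊥-elim (0≢1+n e)
... | no _ | yes _ = ⊥-elim (0≢1+n (sym e))
position-injective (h ∷ t) (here refl) py e | no h≢x | no _ = ⊥-elim (h≢x refl)
position-injective (h ∷ t) (there px) (here refl) e | no _ | no h≢y = ⊥-elim (h≢y refl)
position-injective (h ∷ t) (there px) (there py) e | no _ | no _ =
  position-injective t px py (suc-injective e)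

Before : List ℕ → ℕ → ℕ → Set
Before ℓ x y = x ∈ ℓ × y ∈ ℓ × position ℓ x < position ℓ y

Before? : ∀ ℓ x y → Dec (Before ℓ x y)
Before? ℓ x y = (x ∈? ℓ) ×-dec ((y ∈? ℓ) ×-dec (position ℓ x <? position ℓ y))

Before-∈ˡ : ∀ {ℓ x y} → Before ℓ x y → x ∈ ℓ
Before-∈ˡ (p , _ , _) = p

Before-∈ʳ : ∀ {ℓ x y} → Before ℓ x y → y ∈ ℓ
Before-∈ʳ (_ , p , _) = p

Before-trans : ∀ {ℓ x y z} → Before ℓ x y → Before ℓ y z → Before ℓ x z
Before-trans (px , _ , p) (_ , pz , q) = px , pz , <-trans p q

Before-irrefl : ∀ {ℓ x} → ¬ Before ℓ x x
Before-irrefl (_ , _ , p) = <-irrefl refl p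

Before-asym : ∀ {ℓ x y} → Before ℓ x y → ¬ Before ℓ y x
Before-asym (_ , _ , p) (_ , _ , q) = <-asym p q

Before-total : ∀ {ℓ x y} → x ∈ ℓ → y ∈ ℓ → x ≢ y → Before ℓ x y ⊎ Before ℓ y x
Before-total {ℓ} {x} {y} px py x≢y with <-cmp (position ℓ x) (position ℓ y)
... | tri< lt _ _ = inj₁ (px , py , lt)
... | tri≈ _ eq _ = ⊥-elim (x≢y (position-injective ℓ px py eq))
... | tri> _ _ gt = inj₂ (py , px , gt)

Before-[] : ∀ {x y} → ¬ Before [] x y
Before-[] (() , _)

Before-[_] : ∀ m {x y} → ¬ Before [ m ] x y
Before-[ m ] (here refl , here refl , lt) = <-irrefl refl lt

¬Before-head : ∀ {y z R} → ¬ Before (y ∷ R) z y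
¬Before-head {y} (_ , _ , lt) with y ≟ y
... | yes _ = n≮0 lt
... | no y≢y = y≢y refl

Before-++ˡ : ∀ {x y} A B → Before A x y → Before (A ++ B) x y
Before-++ˡ A B (px , py , lt) =
  ∈-++⁺ˡ px , ∈-++⁺ˡ py , subst₂ _<_ (sym (position-++ˡ A B px)) (sym (position-++ˡ A B py)) lt

Before-++ʳ : ∀ {x y} A B → x ∉ A → y ∉ A → Before B x y → Before (A ++ B) x y
Before-++ʳ A B x∉A y∉A (px , py , lt) =
  ∈-++⁺ʳ A px , ∈-++⁺ʳ A py ,
  subst₂ _<_ (sym (position-++ʳ A B x∉A)) (sym (position-++ʳ A B y∉A)) (+-monoʳ-< (length A) lt)

Before-++-across : ∀ {x y} A B → x ∈ A → y ∉ A → y ∈ B → Before (A ++ B) x y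
Before-++-across A B px y∉A py =
  ∈-++⁺ˡ px , ∈-++⁺ʳ A py ,
  subst₂ _<_ (sym (position-++ˡ A B px)) (sym (position-++ʳ A B y∉A))
    (<-≤-trans (position<length A px) (m≤m+n (length A) _))

data Before-++-View (A B : List ℕ) (x y : ℕ) : Set where
  left   : Before A x y → Before-++-View A B x y
  across : x ∈ A → y ∉ A → y ∈ B → Before-++-View A B x y
  right  : x ∉ A → y ∉ A → Before B x y → Before-++-View A B x y

∈-++-∉ˡ : ∀ {z : ℕ} A {B} → z ∉ A → z ∈ A ++ B → z ∈ B
∈-++-∉ˡ A z∉A q with ∈-++⁻ A q
... | inj₁ z∈A = ⊥-elim (z∉A z∈A)
... | inj₂ z∈B = z∈B

Before-++⁻ : ∀ {x y} A B → Before (A ++ B) x y → Before-++-View A B x y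
Before-++⁻ {x} {y} A B b@(px , py , lt) with x ∈? A | y ∈? A
... | yes x∈A | yes y∈A =
  left (x∈A , y∈A , subst₂ _<_ (position-++ˡ A B x∈A) (position-++ˡ A B y∈A) lt)
... | yes x∈A | no y∉A = across x∈A y∉A (∈-++-∉ˡ A y∉A py)
... | no x∉A | yes y∈A = ⊥-elim (Before-asym b (Before-++-across A B y∈A x∉A (∈-++-∉ˡ A x∉A px)))
... | no x∉A | no y∉A = right x∉A y∉A (∈-++-∉ˡ A x∉A px , ∈-++-∉ˡ A y∉A py ,
        +-cancelˡ-< (length A) _ _ (subst₂ _<_ (position-++ʳ A B x∉A) (position-++ʳ A B y∉A) lt))

Before-++⁻ˡ : ∀ {x y} A B → Before (A ++ B) x y → y ∈ A → Before A x y
Before-++⁻ˡ A B b y∈A with Before-++⁻ A B b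
... | left b′ = b′
... | across _ y∉A _ = ⊥-elim (y∉A y∈A)
... | right _ y∉A _ = ⊥-elim (y∉A y∈A)

Before-++⁻ʳ : ∀ {x y} A B → Before (A ++ B) x y → x ∉ A → Before B x y
Before-++⁻ʳ A B b x∉A with Before-++⁻ A B b
... | left b′ = ⊥-elim (x∉A (Before-∈ˡ b′))
... | across x∈A _ _ = ⊥-elim (x∉A x∈A)
... | right _ _ b′ = b′

Unique-resp-↭ : ∀ {xs ys : List ℕ} → xs ↭ ys → Unique xs → Unique ys
Unique-resp-↭ p = ↭ₛ.Unique-resp-↭ (setoid ℕ) (↭⇒↭ₛ p)

Unique-++⁻ˡ : ∀ (A : List ℕ) {B} → Unique (A ++ B) → Unique A
Unique-++⁻ˡ [] u = []
Unique-++⁻ˡ (x ∷ A) (x∉ ∷ u) = All.++⁻ˡ A x∉ ∷ Unique-++⁻ˡ A u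

Unique-++⁻ʳ : ∀ (A : List ℕ) {B} → Unique (A ++ B) → Unique B
Unique-++⁻ʳ [] u = u
Unique-++⁻ʳ (x ∷ A) (_ ∷ u) = Unique-++⁻ʳ A u

Unique-++⇒disjoint : ∀ (A : List ℕ) {B x} → Unique (A ++ B) → x ∈ A → x ∉ B
Unique-++⇒disjoint (y ∷ A) (y∉ ∷ u) (here refl) q = All.lookup (All.++⁻ʳ A y∉) q refl
Unique-++⇒disjoint (y ∷ A) (_ ∷ u) (there p) q = Unique-++⇒disjoint A u p q

-- The stack-sorting map as a relation

-- The graph of s, by induction on the decomposition L m R instead of on fuel.
data Sorts : List ℕ → List ℕ → Set where
  empty : Sorts [] []
  node  : ∀ {L R πL πR m} → Sorts L πL → Sorts R πR → All (_< m) L → All (_< m) R →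
          Sorts (L ++ m ∷ R) (πL ++ πR ++ [ m ])

Sorts-↭ : ∀ {ℓ π} → Sorts ℓ π → ℓ ↭ π
Sorts-↭ empty = ↭-refl
Sorts-↭ (node {L} {R} {m = m} sL sR _ _) =
  ↭-trans (↭.++⁺ˡ L (↭.++-comm [ m ] R)) (↭.++⁺ (Sorts-↭ sL) (↭.++⁺ (Sorts-↭ sR) ↭-refl))

maxL≤ : ∀ {m} xs → All (_≤ m) xs → maxL xs ≤ m
maxL≤ [] _ = z≤n
maxL≤ (x ∷ xs) (p ∷ ps) = ⊔-lub p (maxL≤ xs ps)

≤maxL : ∀ {m} xs → m ∈ xs → m ≤ maxL xs
≤maxL (x ∷ xs) (here refl) = m≤m⊔n x (maxL xs)
≤maxL (x ∷ xs) (there p) = ≤-trans (≤maxL xs p) (m≤n⊔m x (maxL xs))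

maxL∈ : ∀ x xs → maxL (x ∷ xs) ∈ x ∷ xs
maxL∈ x [] rewrite ⊔-identityʳ x = here refl
maxL∈ x (y ∷ ys) with ⊔-sel x (maxL (y ∷ ys))
... | inj₁ e rewrite e = here refl
... | inj₂ e rewrite e = there (maxL∈ y ys)

maxL-node : ∀ L m R → All (_< m) L → All (_< m) R → maxL (L ++ m ∷ R) ≡ m
maxL-node L m R aL aR =
  ≤-antisym (maxL≤ (L ++ m ∷ R) (All.++⁺ (All.map <⇒≤ aL) (≤-refl ∷ All.map <⇒≤ aR)))
            (≤maxL (L ++ m ∷ R) (∈-++⁺ʳ L (here refl)))

≡ᵇ-refl : ∀ m → (m ≡ᵇ m) ≡ true
≡ᵇ-refl zero = refl
≡ᵇ-refl (suc m) = ≡ᵇ-refl m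

≡ᵇ-≢ : ∀ {x m} → x ≢ m → (x ≡ᵇ m) ≡ false
≡ᵇ-≢ {x} {m} x≢m with x ≡ᵇ m in eq
... | true = ⊥-elim (x≢m (≡ᵇ⇒≡ x m (subst T (sym eq) _)))
... | false = refl

span-node : ∀ L m R → All (_< m) L → span (λ y → ¬? (y ≟ m)) (L ++ m ∷ R) ≡ (L , m ∷ R)
span-node [] m R aL rewrite ≡ᵇ-refl m = refl
span-node (x ∷ L) m R (x<m ∷ aL)
  rewrite ≡ᵇ-≢ (<⇒≢ x<m) | span-node L m R aL = refl

sFuel-node : ∀ k L m R → All (_< m) L → All (_< m) R →
  sFuel (suc k) (L ++ m ∷ R) ≡ sFuel k L ++ sFuel k R ++ [ m ]
sFuel-node k [] m R aL aR rewrite maxL-node [] m R aL aR | span-node [] m R aL = refl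
sFuel-node k (x ∷ L) m R aL aR
  rewrite maxL-node (x ∷ L) m R aL aR | span-node (x ∷ L) m R aL = refl

length-node : ∀ (L : List ℕ) m R → length (L ++ m ∷ R) ≡ suc (length L + length R)
length-node L m R = trans (length-++ L) (+-suc (length L) (length R))

sFuel-Sorts : ∀ {ℓ π} → Sorts ℓ π → ∀ k → length ℓ ≤ k → sFuel k ℓ ≡ π
sFuel-Sorts empty zero _ = refl
sFuel-Sorts empty (suc k) _ = refl
sFuel-Sorts (node {L} {R} {m = m} sL sR _ _) zero le
  with () ← subst (_≤ 0) (length-node L m R) le
sFuel-Sorts (node {L} {R} {m = m} sL sR aL aR) (suc k) le =
  trans (sFuel-node k L m R aL aR)
        (cong₂ (λ a b → a ++ b ++ [ m ])
               (sFuel-Sorts sL k (≤-trans (m≤m+n _ _) |L|+|R|≤k))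
               (sFuel-Sorts sR k (≤-trans (m≤n+m _ _) |L|+|R|≤k)))
  where
  |L|+|R|≤k : length L + length R ≤ k
  |L|+|R|≤k = s≤s⁻¹ (subst (_≤ suc k) (length-node L m R) le)

s-Sorts : ∀ {ℓ π} → Sorts ℓ π → s ℓ ≡ π
s-Sorts {ℓ} sℓ = sFuel-Sorts sℓ (length ℓ) ≤-refl

split-first : ∀ {m} ℓ → m ∈ ℓ → Σ (List ℕ) λ L → Σ (List ℕ) λ R → (ℓ ≡ L ++ m ∷ R) × m ∉ L
split-first {m} (h ∷ t) p with h ≟ m
... | yes refl = [] , t , refl , λ ()
split-first (h ∷ t) (here refl) | no h≢m = ⊥-elim (h≢m refl)
split-first (h ∷ t) (there p) | no h≢m with split-first t p
... | L , R , refl , m∉L = h ∷ L , R , refl , λ { (here e) → h≢m (sym e) ; (there q) → m∉L q }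

Sorts-exists : ∀ k ℓ → length ℓ ≤ k → Unique ℓ → ∃ (Sorts ℓ)
Sorts-exists k [] _ _ = [] , empty
Sorts-exists (suc k) (x ∷ xs) (s≤s le) u
  with split-first (x ∷ xs) (maxL∈ x xs)
... | L , R , ℓ≡ , m∉L =
  subst (λ ℓ → ∃ (Sorts ℓ)) (sym ℓ≡)
        (_ , node (proj₂ (Sorts-exists k L |L|≤k uL)) (proj₂ (Sorts-exists k R |R|≤k uR)) aL aR)
  where
  m = maxL (x ∷ xs)
  u′ = subst Unique ℓ≡ u
  uL = Unique-++⁻ˡ L u′
  uR = Unique-++⁻ʳ [ m ] (Unique-++⁻ʳ L u′)
  below : ∀ {y} → y ∈ L ++ m ∷ R → y ≢ m → y < m
  below q y≢m = ≤∧≢⇒< (≤maxL (x ∷ xs) (subst (_ ∈_) (sym ℓ≡) q)) y≢m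
  aL : All (_< m) L
  aL = All.tabulate λ q → below (∈-++⁺ˡ q) (λ { refl → m∉L q })
  aR : All (_< m) R
  aR = All.tabulate λ q → below (∈-++⁺ʳ L (there q))
                                (λ { refl → Unique-++⇒disjoint [ m ] (Unique-++⁻ʳ L u′) (here refl) q })
  |L|+|R|≤k : length L + length R ≤ k
  |L|+|R|≤k = s≤s⁻¹ (subst (_≤ suc k) (length-node L m R)
                           (subst (λ ℓ → length ℓ ≤ suc k) ℓ≡ (s≤s le)))
  |L|≤k = ≤-trans (m≤m+n _ _) |L|+|R|≤k
  |R|≤k = ≤-trans (m≤n+m _ _) |L|+|R|≤k

Sorts-s : ∀ ℓ → Unique ℓ → Sorts ℓ (s ℓ)
Sorts-s ℓ u with Sorts-exists (length ℓ) ℓ ≤-refl u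
... | π , sℓ = subst (Sorts ℓ) (sym (s-Sorts sℓ)) sℓ

LargerBetween : List ℕ → ℕ → ℕ → Set
LargerBetween ℓ x y = Σ ℕ λ z → Before ℓ x z × Before ℓ z y × x < z

SmallerBetween : List ℕ → ℕ → ℕ → Set
SmallerBetween ℓ x y = ∀ z → Before ℓ x z → Before ℓ z y → z < x

LargerBetween⇒Before : ∀ {ℓ x y} → LargerBetween ℓ x y → Before ℓ x y
LargerBetween⇒Before (_ , xz , zy , _) = Before-trans xz zy

module Node {L R πL πR : List ℕ} {m : ℕ} (sL : Sorts L πL) (sR : Sorts R πR)
            (aL : All (_< m) L) (aR : All (_< m) R) (u : Unique (L ++ m ∷ R)) where
  ℓ = L ++ m ∷ R
  π = πL ++ πR ++ [ m ]

  uL : Unique L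
  uL = Unique-++⁻ˡ L u
  uR : Unique R
  uR = Unique-++⁻ʳ [ m ] (Unique-++⁻ʳ L u)

  m∉L : m ∉ L
  m∉L q = <-irrefl refl (All.lookup aL q)
  m∉R : m ∉ R
  m∉R q = <-irrefl refl (All.lookup aR q)
  R∉L : ∀ {x} → x ∈ R → x ∉ L
  R∉L q p = Unique-++⇒disjoint L u p (there q)
  R∉[m] : ∀ {x} → x ∈ R → x ∉ [ m ]
  R∉[m] q (here refl) = m∉R q

  ∈πL : ∀ {x} → x ∈ L → x ∈ πL
  ∈πL = ↭.∈-resp-↭ (Sorts-↭ sL)
  ∈πR : ∀ {x} → x ∈ R → x ∈ πR
  ∈πR = ↭.∈-resp-↭ (Sorts-↭ sR)
  πL∈ : ∀ {x} → x ∈ πL → x ∈ L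
  πL∈ = ↭.∈-resp-↭ (↭-sym (Sorts-↭ sL))
  πR∈ : ∀ {x} → x ∈ πR → x ∈ R
  πR∈ = ↭.∈-resp-↭ (↭-sym (Sorts-↭ sR))
  ∉πL : ∀ {x} → x ∉ L → x ∉ πL
  ∉πL x∉L q = x∉L (πL∈ q)

  ≤m : ∀ {x} → x ∈ ℓ → x ≤ m
  ≤m q with ∈-++⁻ L q
  ... | inj₁ x∈L = <⇒≤ (All.lookup aL x∈L)
  ... | inj₂ (here refl) = ≤-refl
  ... | inj₂ (there x∈R) = <⇒≤ (All.lookup aR x∈R)

  Before-L : ∀ {x y} → Before L x y → Before ℓ x y
  Before-L = Before-++ˡ L (m ∷ R)
  Before-R : ∀ {x y} → Before R x y → Before ℓ x y
  Before-R b = Before-++ʳ L (m ∷ R) (R∉L (Before-∈ˡ b)) (R∉L (Before-∈ʳ b))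
                 (Before-++ʳ [ m ] R (R∉[m] (Before-∈ˡ b)) (R∉[m] (Before-∈ʳ b)) b)
  Before-πL : ∀ {x y} → Before πL x y → Before π x y
  Before-πL = Before-++ˡ πL (πR ++ [ m ])
  Before-πR : ∀ {x y} → Before πR x y → Before π x y
  Before-πR b = Before-++ʳ πL (πR ++ [ m ]) (∉πL (R∉L (πR∈ (Before-∈ˡ b))))
                  (∉πL (R∉L (πR∈ (Before-∈ʳ b)))) (Before-++ˡ πR [ m ] b)

  L-before-m : ∀ {x} → x ∈ L → Before ℓ x m
  L-before-m x∈L = Before-++-across L (m ∷ R) x∈L m∉L (here refl)
  m-before-R : ∀ {y} → y ∈ R → Before ℓ m y
  m-before-R y∈R = Before-++ʳ L (m ∷ R) m∉L (R∉L y∈R) (Before-++-across [ m ] R (here refl) (R∉[m] y∈R) y∈R)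
  L-before-R-in-π : ∀ {x y} → x ∈ L → y ∈ R → Before π x y
  L-before-R-in-π x∈L y∈R =
    Before-++-across πL (πR ++ [ m ]) (∈πL x∈L) (∉πL (R∉L y∈R)) (∈-++⁺ˡ (∈πR y∈R))
  L-before-m-in-π : ∀ {x} → x ∈ L → Before π x m
  L-before-m-in-π x∈L = Before-++-across πL (πR ++ [ m ]) (∈πL x∈L) (∉πL m∉L) (∈-++⁺ʳ πR (here refl))
  R-before-m-in-π : ∀ {x} → x ∈ R → Before π x m
  R-before-m-in-π x∈R = Before-++ʳ πL (πR ++ [ m ]) (∉πL (R∉L x∈R)) (∉πL m∉L)
                          (Before-++-across πR [ m ] (∈πR x∈R) (λ q → m∉R (πR∈ q)) (here refl))

  data ℓ-View (x y : ℕ) : Set where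
    inL : Before L x y → ℓ-View x y
    LR  : x ∈ L → y ∈ R → ℓ-View x y
    Lm  : x ∈ L → y ≡ m → ℓ-View x y
    mR  : x ≡ m → y ∈ R → ℓ-View x y
    inR : Before R x y → ℓ-View x y

  ℓ-view : ∀ {x y} → Before ℓ x y → ℓ-View x y
  ℓ-view b with Before-++⁻ L (m ∷ R) b
  ... | left b′ = inL b′
  ... | across x∈L _ (here refl) = Lm x∈L refl
  ... | across x∈L _ (there y∈R) = LR x∈L y∈R
  ... | right _ _ b′ with Before-++⁻ [ m ] R b′
  ...   | left b″ = ⊥-elim (Before-[ m ] b″)
  ...   | across (here refl) _ y∈R = mR refl y∈R
  ...   | right _ _ b″ = inR b″

  data π-View (x y : ℕ) : Set where
    inπL : Before πL x y → π-View x y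
    LR   : x ∈ L → y ∈ R → π-View x y
    Lm   : x ∈ L → y ≡ m → π-View x y
    inπR : Before πR x y → π-View x y
    Rm   : x ∈ R → y ≡ m → π-View x y

  π-view : ∀ {x y} → Before π x y → π-View x y
  π-view b with Before-++⁻ πL (πR ++ [ m ]) b
  ... | left b′ = inπL b′
  ... | across x∈πL _ q with ∈-++⁻ πR q
  ...   | inj₁ y∈πR = LR (πL∈ x∈πL) (πR∈ y∈πR)
  ...   | inj₂ (here refl) = Lm (πL∈ x∈πL) refl
  π-view b | right _ _ b′ with Before-++⁻ πR [ m ] b′
  ...   | left b″ = inπR b″
  ...   | across x∈πR _ (here refl) = Rm (πR∈ x∈πR) refl
  ...   | right _ _ b″ = ⊥-elim (Before-[ m ] b″)

  between-L : ∀ {x y z} → y ∈ L → Before ℓ x z → Before ℓ z y → Before L x z × Before L z y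
  between-L y∈L xz zy = let zy′ = Before-++⁻ˡ L (m ∷ R) zy y∈L in
    Before-++⁻ˡ L (m ∷ R) xz (Before-∈ˡ zy′) , zy′

  between-R : ∀ {x y z} → x ∈ R → Before ℓ x z → Before ℓ z y → Before R x z × Before R z y
  between-R x∈R xz zy = xz′ , zy′
    where
    inR′ : ∀ {a b} → a ∈ R → Before ℓ a b → Before R a b
    inR′ a∈R b = Before-++⁻ʳ [ m ] R (Before-++⁻ʳ L (m ∷ R) b (R∉L a∈R)) (R∉[m] a∈R)
    xz′ = inR′ x∈R xz
    zy′ = inR′ (Before-∈ʳ xz′) zy

s-ascent⁺ : ∀ {ℓ π x y} → Sorts ℓ π → Unique ℓ → x < y → Before ℓ x y → Before π x y
s-ascent⁺ empty u x<y b = ⊥-elim (Before-[] b)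
s-ascent⁺ {x = x} {y} (node sL sR aL aR) u x<y b = go (ℓ-view b)
  where
  open Node sL sR aL aR u
  go : ℓ-View x y → Before π x y
  go (inL b′) = Before-πL (s-ascent⁺ sL uL x<y b′)
  go (LR x∈L y∈R) = L-before-R-in-π x∈L y∈R
  go (Lm x∈L refl) = L-before-m-in-π x∈L
  go (mR refl y∈R) = ⊥-elim (<-asym x<y (All.lookup aR y∈R))
  go (inR b′) = Before-πR (s-ascent⁺ sR uR x<y b′)

s-descent⁻ : ∀ {ℓ π x y} → Sorts ℓ π → Unique ℓ → y < x → Before π x y → LargerBetween ℓ x y
s-descent⁻ empty u y<x b = ⊥-elim (Before-[] b)
s-descent⁻ {x = x} {y} (node {m = m} sL sR aL aR) u y<x b = go (π-view b)
  where
  open Node sL sR aL aR u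
  lift : ∀ {K} → (∀ {a b} → Before K a b → Before ℓ a b) → LargerBetween K x y → LargerBetween ℓ x y
  lift f (z , xz , zy , x<z) = z , f xz , f zy , x<z
  go : π-View x y → LargerBetween ℓ x y
  go (inπL b′) = lift Before-L (s-descent⁻ sL uL y<x b′)
  go (LR x∈L y∈R) = m , L-before-m x∈L , m-before-R y∈R , All.lookup aL x∈L
  go (Lm x∈L refl) = ⊥-elim (<-asym y<x (All.lookup aL x∈L))
  go (inπR b′) = lift Before-R (s-descent⁻ sR uR y<x b′)
  go (Rm x∈R refl) = ⊥-elim (<-asym y<x (All.lookup aR x∈R))

s-descent⁺ : ∀ {ℓ π x y} → Sorts ℓ π → Unique ℓ → y < x → LargerBetween ℓ x y → Before π x y
s-descent⁺ empty u y<x (_ , b , _) = ⊥-elim (Before-[] b)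
s-descent⁺ {x = x} {y} (node sL sR aL aR) u y<x lb@(z , xz , zy , x<z) = go (ℓ-view (LargerBetween⇒Before lb))
  where
  open Node sL sR aL aR u
  go : ℓ-View x y → Before π x y
  go (inL b′) with between-L (Before-∈ʳ b′) xz zy
  ... | xz′ , zy′ = Before-πL (s-descent⁺ sL uL y<x (z , xz′ , zy′ , x<z))
  go (LR x∈L y∈R) = L-before-R-in-π x∈L y∈R
  go (Lm x∈L refl) = ⊥-elim (<-asym y<x (All.lookup aL x∈L))
  go (mR refl y∈R) = ⊥-elim (<⇒≱ x<z (≤m (Before-∈ʳ xz)))
  go (inR b′) with between-R (Before-∈ˡ b′) xz zy
  ... | xz′ , zy′ = Before-πR (s-descent⁺ sR uR y<x (z , xz′ , zy′ , x<z))

s-sorts-inversion : ∀ {ℓ π x y} → Sorts ℓ π → Unique ℓ → x < y → Before ℓ y x →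
                    SmallerBetween ℓ y x → Before π x y
s-sorts-inversion empty u x<y b h = ⊥-elim (Before-[] b)
s-sorts-inversion {x = x} {y} (node {m = m} sL sR aL aR) u x<y b h = go (ℓ-view b)
  where
  open Node sL sR aL aR u
  go : ℓ-View y x → Before π x y
  go (inL b′) = Before-πL (s-sorts-inversion sL uL x<y b′ (λ z b₁ b₂ → h z (Before-L b₁) (Before-L b₂)))
  go (LR y∈L x∈R) = ⊥-elim (<-asym (h m (L-before-m y∈L) (m-before-R x∈R)) (All.lookup aL y∈L))
  go (Lm y∈L refl) = ⊥-elim (<-asym x<y (All.lookup aL y∈L))
  go (mR refl x∈R) = R-before-m-in-π x∈R
  go (inR b′) = Before-πR (s-sorts-inversion sR uR x<y b′ (λ z b₁ b₂ → h z (Before-R b₁) (Before-R b₂)))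

module _ {P : ℕ → Set} (P? : Decidable P) where

  count : List ℕ → ℕ
  count xs = length (filter P? xs)

  count-++ : ∀ A B → count (A ++ B) ≡ count A + count B
  count-++ A B = trans (cong length (filter-++ P? A B)) (length-++ (filter P? A))

  maximum-satisfying : ∀ ℓ → (∀ z → z ∈ ℓ → ¬ P z) ⊎
                       (Σ ℕ λ g → g ∈ ℓ × P g × (∀ z → z ∈ ℓ → P z → z ≤ g))
  maximum-satisfying [] = inj₁ (λ z ())
  maximum-satisfying (h ∷ t) with P? h | maximum-satisfying t
  ... | no ¬ph | inj₁ none = inj₁ λ { z (here refl) pz → ¬ph pz ; z (there q) pz → none z q pz }
  ... | no ¬ph | inj₂ (g , g∈ , pg , max) =
    inj₂ (g , there g∈ , pg , λ { z (here refl) pz → ⊥-elim (¬ph pz) ; z (there q) pz → max z q pz })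
  ... | yes ph | inj₁ none =
    inj₂ (h , here refl , ph , λ { z (here refl) _ → ≤-refl ; z (there q) pz → ⊥-elim (none z q pz) })
  ... | yes ph | inj₂ (g , g∈ , pg , max) with h ≤? g
  ...   | yes h≤g = inj₂ (g , there g∈ , pg , λ { z (here refl) _ → h≤g ; z (there q) pz → max z q pz })
  ...   | no h≰g = inj₂ (h , here refl , ph ,
                         λ { z (here refl) _ → ≤-refl ; z (there q) pz → ≤-trans (max z q pz) (<⇒≤ (≰⇒> h≰g)) })

module _ {P Q : ℕ → Set} (P? : Decidable P) (Q? : Decidable Q) where

  count-mono : ∀ U → (∀ x → x ∈ U → P x → Q x) → count P? U ≤ count Q? U
  count-mono [] f = z≤n
  count-mono (h ∷ t) f with P? h | Q? h
  ... | yes p | yes q = s≤s (count-mono t (λ x i → f x (there i)))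
  ... | yes p | no ¬q = ⊥-elim (¬q (f h (here refl) p))
  ... | no ¬p | yes q = m≤n⇒m≤1+n (count-mono t (λ x i → f x (there i)))
  ... | no ¬p | no ¬q = count-mono t (λ x i → f x (there i))

  count-mono-< : ∀ U {y} → (∀ x → x ∈ U → P x → Q x) → y ∈ U → Q y → ¬ P y → count P? U < count Q? U
  count-mono-< (h ∷ t) f (here refl) qy ¬py with P? h | Q? h
  ... | yes p | _ = ⊥-elim (¬py p)
  ... | no ¬p | yes q = s≤s (count-mono t (λ x i → f x (there i)))
  ... | no ¬p | no ¬q = ⊥-elim (¬q qy)
  count-mono-< (h ∷ t) f (there y∈t) qy ¬py with P? h | Q? h
  ... | yes p | yes q = s≤s (count-mono-< t (λ x i → f x (there i)) y∈t qy ¬py)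
  ... | yes p | no ¬q = ⊥-elim (¬q (f h (here refl) p))
  ... | no ¬p | yes q = m≤n⇒m≤1+n (count-mono-< t (λ x i → f x (there i)) y∈t qy ¬py)
  ... | no ¬p | no ¬q = count-mono-< t (λ x i → f x (there i)) y∈t qy ¬py

range-snoc : ∀ n → range (suc n) ≡ range n ++ [ suc n ]
range-snoc n = trans (cong (map suc) (sym (upTo-∷ʳ n))) (map-++ suc (upTo n) [ n ])

range-cons : ∀ n → range (suc n) ≡ 1 ∷ map suc (range n)
range-cons n = cong (λ xs → 1 ∷ map suc xs) (sym (map-upTo suc n))

length-range : ∀ n → length (range n) ≡ n
length-range n = trans (length-map suc (upTo n)) (length-upTo n)

↭range⇒length : ∀ {X n} → X ↭ range n → length X ≡ n
↭range⇒length {n = n} p = trans (↭.↭-length p) (length-range n)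

length-snoc : ∀ (X : List ℕ) a → length (X ++ [ a ]) ≡ suc (length X)
length-snoc X a = trans (length-++ X) (+-comm _ 1)

↭-drop-last : ∀ {X Y : List ℕ} a → X ++ [ a ] ↭ Y ++ [ a ] → X ↭ Y
↭-drop-last {X} {Y} a p = subst₂ _↭_ (++-identityʳ X) (++-identityʳ Y) (↭.drop-mid X Y p)

Unique-range : ∀ n → Unique (range n)
Unique-range n = Unique.map⁺ suc-injective (Unique.upTo⁺ n)

↭range⇒Unique : ∀ {X} n → X ↭ range n → Unique X
↭range⇒Unique n p = Unique-resp-↭ (↭-sym p) (Unique-range n)

∈range⇒1≤ : ∀ {y} n → y ∈ range n → 1 ≤ y
∈range⇒1≤ n q with ∈-map⁻ suc q
... | _ , _ , refl = s≤s z≤n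

∈range⇒≤ : ∀ {y} n → y ∈ range n → y ≤ n
∈range⇒≤ {y} (suc n) q with ∈-++⁻ (range n) (subst (y ∈_) (range-snoc n) q)
... | inj₁ q′ = m≤n⇒m≤1+n (∈range⇒≤ n q′)
... | inj₂ (here refl) = ≤-refl

count-range-> : ∀ x n → count (x <?_) (range n) ≤ n ∸ x
count-range-> x zero = z≤n
count-range-> x (suc n) = begin
  count (x <?_) (range (suc n))                     ≡⟨ cong (count (x <?_)) (range-snoc n) ⟩
  count (x <?_) (range n ++ [ suc n ])              ≡⟨ count-++ (x <?_) (range n) [ suc n ] ⟩
  count (x <?_) (range n) + count (x <?_) [ suc n ] ≤⟨ +-monoˡ-≤ _ (count-range-> x n) ⟩
  n ∸ x + count (x <?_) [ suc n ]                   ≤⟨ last (x <? suc n) ⟩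
  suc n ∸ x ∎
  where
  open ≤-Reasoning
  last : Dec (x < suc n) → n ∸ x + count (x <?_) [ suc n ] ≤ suc n ∸ x
  last (yes x<1+n) = ≤-reflexive (begin-equality
    n ∸ x + count (x <?_) [ suc n ] ≡⟨ cong (λ xs → n ∸ x + length xs) (filter-accept (x <?_) x<1+n) ⟩
    n ∸ x + 1                       ≡⟨ +-comm (n ∸ x) 1 ⟩
    suc (n ∸ x)                     ≡⟨ +-∸-assoc 1 (s≤s⁻¹ x<1+n) ⟨
    suc n ∸ x ∎)
  last (no x≮1+n) = begin
    n ∸ x + count (x <?_) [ suc n ] ≡⟨ cong (λ xs → n ∸ x + length xs) (filter-reject (x <?_) x≮1+n) ⟩
    n ∸ x + 0                       ≡⟨ +-identityʳ _ ⟩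
    n ∸ x                           ≤⟨ ∸-monoˡ-≤ x (n≤1+n n) ⟩
    suc n ∸ x ∎

iter-s-↭ : ∀ σ → Unique σ → ∀ k → iter k s σ ↭ σ
iter-s-↭ σ u zero = ↭-refl
iter-s-↭ σ u (suc k) = ↭-trans (↭-sym (Sorts-↭ (Sorts-s _ (Unique-resp-↭ (↭-sym ih) u)))) ih
  where ih = iter-s-↭ σ u k

iter-s-Unique : ∀ σ → Unique σ → ∀ k → Unique (iter k s σ)
iter-s-Unique σ u k = Unique-resp-↭ (↭-sym (iter-s-↭ σ u k)) u

-- Obstructions: descent tops that are not left-to-right maxima

record Obstruction (ℓ : List ℕ) (d b a : ℕ) : Set where
  constructor obstruction
  field
    d-before-b   : Before ℓ d b
    b-before-a   : Before ℓ b a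
    b<d          : b < d
    a<b          : a < b
    only-smaller : SmallerBetween ℓ b a

GreatestBetween : List ℕ → ℕ → ℕ → ℕ → Set
GreatestBetween ℓ x y g = Before ℓ x g × Before ℓ g y × (∀ w → Before ℓ x w → Before ℓ w y → w ≤ g)

greatest-between : ∀ {ℓ x y} → LargerBetween ℓ x y → Σ ℕ λ g → GreatestBetween ℓ x y g × x < g
greatest-between {ℓ} {x} {y} (z , xz , zy , x<z)
  with maximum-satisfying (λ w → Before? ℓ x w ×-dec Before? ℓ w y) ℓ
... | inj₁ none = ⊥-elim (none z (Before-∈ʳ xz) (xz , zy))
... | inj₂ (g , _ , (xg , gy) , max) =
  g , (xg , gy , λ w xw wy → max w (Before-∈ʳ xw) (xw , wy)) , <-≤-trans x<z (max z (Before-∈ʳ xz) (xz , zy))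

GreatestBetween⇒SmallerBetween : ∀ {ℓ x y g} → GreatestBetween ℓ x y g → SmallerBetween ℓ g y
GreatestBetween⇒SmallerBetween (xg , _ , max) z gz zy =
  ≤∧≢⇒< (max z (Before-trans xg gz) zy) (λ { refl → Before-irrefl gz })

record Pullback (ρ π : List ℕ) (b a : ℕ) : Set where
  field
    g c          : ℕ
    obstruction′ : Obstruction ρ g c a
    b<c          : b < c
    a-before-c   : Before π a c
    a-before-g   : Before π a g

-- c is the largest entry of ρ between b and a, and g the largest between d and b.
obstruction-pullback : ∀ {ρ π d b a} → Sorts ρ π → Unique ρ → Obstruction π d b a → Pullback ρ π b a
obstruction-pullback {ρ} {π} {d} {b} {a} sρ u (obstruction db ba b<d a<b small)
  with greatest-between (s-descent⁻ sρ u a<b ba) | greatest-between (s-descent⁻ sρ u b<d db)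
... | c , gc@(bc , ca , c-max) , b<c | g , gg@(_ , gb , _) , d<g = record
  { g = g ; c = c
  ; obstruction′ = obstruction (Before-trans gb bc) ca c<g a<c (GreatestBetween⇒SmallerBetween gc)
  ; b<c = b<c ; a-before-c = πac ; a-before-g = πag }
  where
  a<c = <-trans a<b b<c
  b<g = <-trans b<d d<g
  ρba = Before-trans bc ca
  ga = Before-trans gb ρba
  small-g-b = GreatestBetween⇒SmallerBetween gg

  πac : Before π a c
  πac with Before-total (↭.∈-resp-↭ (Sorts-↭ sρ) (Before-∈ʳ bc)) (Before-∈ʳ ba) (≢-sym (<⇒≢ a<c))
  ... | inj₁ πca = ⊥-elim (<-asym (small c (s-ascent⁺ sρ u b<c bc) πca) b<c)
  ... | inj₂ πac = πac

  -- If g < c, then c would separate g from a and force g between b and a in π.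
  c<g : c < g
  c<g with <-cmp g c
  ... | tri≈ _ refl _ = ⊥-elim (Before-asym gb bc)
  ... | tri> _ _ c<g = c<g
  ... | tri< g<c _ _ = ⊥-elim (<-asym (small g πbg πga) b<g)
    where
    πbg = s-sorts-inversion sρ u b<g gb small-g-b
    πga = s-descent⁺ sρ u (<-trans a<b b<g) (c , Before-trans gb bc , ca , g<c)

  πag : Before π a g
  πag = s-sorts-inversion sρ u (<-trans a<c c<g) ga small-g-a
    where
    small-g-a : SmallerBetween ρ g a
    small-g-a z gz za with z ≟ b
    ... | yes refl = b<g
    ... | no z≢b with Before-total (Before-∈ʳ gz) (Before-∈ˡ ρba) z≢b
    ...   | inj₁ zb = small-g-b z gz zb
    ...   | inj₂ bz = ≤-<-trans (c-max z bz za) c<g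

LargerAfter : List ℕ → ℕ → ℕ → ℕ → Set
LargerAfter ℓ b a x = b < x × Before ℓ a x

LargerAfter? : ∀ ℓ b a → Decidable (LargerAfter ℓ b a)
LargerAfter? ℓ b a x = (b <? x) ×-dec Before? ℓ a x

-- Each pullback through s contributes the two new entries c and g, both larger than b and after a.
obstruction-count : ∀ σ U → Unique σ → (∀ {x} → x ∈ σ → x ∈ U) → ∀ k {d b a} →
  Obstruction (iter k s σ) d b a → k + k ≤ count (LargerAfter? (iter k s σ) b a) U
obstruction-count σ U u σ⊆U zero _ = z≤n
obstruction-count σ U u σ⊆U (suc k) {d} {b} {a} ob = begin
  suc k + suc k                            ≡⟨ cong suc (+-suc k k) ⟩
  suc (suc (k + k))                        ≤⟨ s≤s (s≤s (obstruction-count σ U u σ⊆U k obstruction′)) ⟩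
  suc (suc (count (LargerAfter? ρ c a) U)) ≤⟨ s≤s c-counted ⟩
  suc (count LargerAfter-or-c? U)          ≤⟨ g-counted ⟩
  count (LargerAfter? (s ρ) b a) U         ∎
  where
  open ≤-Reasoning
  ρ = iter k s σ
  uρ = iter-s-Unique σ u k
  sρ = Sorts-s ρ uρ
  open Pullback (obstruction-pullback sρ uρ ob)
  open Obstruction obstruction′ renaming (b<d to c<g; a<b to a<c)
  c∈ρ = Before-∈ʳ d-before-b
  g∈ρ = Before-∈ˡ d-before-b
  inU : ∀ {x} → x ∈ ρ → x ∈ U
  inU q = σ⊆U (↭.∈-resp-↭ (iter-s-↭ σ u k) q)
  LargerAfter-or-c? : Decidable (λ x → LargerAfter ρ c a x ⊎ x ≡ c)
  LargerAfter-or-c? x = LargerAfter? ρ c a x ⊎-dec (x ≟ c)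
  widen : ∀ x → x ∈ U → LargerAfter ρ c a x ⊎ x ≡ c → LargerAfter (s ρ) b a x
  widen x _ (inj₁ (c<x , ax)) = <-trans b<c c<x , s-ascent⁺ sρ uρ (<-trans a<c c<x) ax
  widen x _ (inj₂ refl) = b<c , a-before-c
  g-new : ¬ (LargerAfter ρ c a g ⊎ g ≡ c)
  g-new (inj₁ (_ , ag)) = Before-asym (Before-trans d-before-b b-before-a) ag
  g-new (inj₂ g≡c) = <-irrefl (sym g≡c) c<g
  c-counted : count (LargerAfter? ρ c a) U < count LargerAfter-or-c? U
  c-counted = count-mono-< _ _ U (λ _ _ → inj₁) (inU c∈ρ) (inj₂ refl) (λ (c<c , _) → <-irrefl refl c<c)
  g-counted : count LargerAfter-or-c? U < count (LargerAfter? (s ρ) b a) U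
  g-counted = count-mono-< _ _ U widen (inU g∈ρ) (<-trans b<c c<g , a-before-g) g-new

∈iter⇒∈range : ∀ n t {σ z} → σ ↭ range n → z ∈ iter t s σ → z ∈ range n
∈iter⇒∈range n t σ↭ q = ↭.∈-resp-↭ σ↭ (↭.∈-resp-↭ (iter-s-↭ _ (↭range⇒Unique n σ↭) t) q)

obstruction-bound : ∀ n t σ {d b a} → σ ↭ range n → Obstruction (iter t s σ) d b a → suc (t + t) ≤ n ∸ b
obstruction-bound n t σ {d} {b} {a} σ↭ ob@(obstruction db ba b<d _ _) = begin
  suc (t + t)                                           ≤⟨ s≤s pulled-back ⟩
  suc (count (LargerAfter? (iter t s σ) b a) (range n)) ≤⟨ d-counted ⟩
  count (b <?_) (range n)                               ≤⟨ count-range-> b n ⟩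
  n ∸ b                                                 ∎
  where
  open ≤-Reasoning
  pulled-back = obstruction-count σ (range n) (↭range⇒Unique n σ↭) (↭.∈-resp-↭ σ↭) t ob
  d-not-after : ¬ LargerAfter (iter t s σ) b a d
  d-not-after (_ , ad) = Before-asym (Before-trans db ba) ad
  d-counted =
    count-mono-< _ _ (range n) (λ _ _ → proj₁) (∈iter⇒∈range n t σ↭ (Before-∈ˡ db)) b<d d-not-after

adjacent-descent-obstruction : ∀ L x y R {d} → Unique (L ++ x ∷ y ∷ R) → d ∈ L → x < d → y < x →
                               Obstruction (L ++ x ∷ y ∷ R) d x y
adjacent-descent-obstruction L x y R u d∈L x<d y<x =
  obstruction (Before-++-across L (x ∷ y ∷ R) d∈L x∉L (here refl)) xy x<d y<x nothing-between
  where
  x∉L : x ∉ L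
  x∉L q = Unique-++⇒disjoint L u q (here refl)
  y∉L : y ∉ L
  y∉L q = Unique-++⇒disjoint L u q (there (here refl))
  xy = Before-++ʳ L (x ∷ y ∷ R) x∉L y∉L
         (Before-++-across [ x ] (y ∷ R) (here refl) (λ { (here y≡x) → <-irrefl y≡x y<x }) (here refl))
  nothing-between : SmallerBetween (L ++ x ∷ y ∷ R) x y
  nothing-between z xz zy with Before-++⁻ L (x ∷ y ∷ R) xz
  ... | left b = ⊥-elim (x∉L (Before-∈ˡ b))
  ... | across x∈L _ _ = ⊥-elim (x∉L x∈L)
  ... | right _ z∉L xz′ =
    ⊥-elim (¬Before-head (Before-++⁻ʳ [ x ] (y ∷ R) (Before-++⁻ʳ L (x ∷ y ∷ R) zy z∉L) z∉[x]))
    where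
    z∉[x] : z ∉ [ x ]
    z∉[x] (here refl) = Before-irrefl xz′

descent-top-isLRMax : ∀ n t σ → σ ↭ range n → n ∸ 2 ≤ t + t →
                      ∀ x → IsDescentTop (iter t s σ) x → IsLRMax (iter t s σ) x
descent-top-isLRMax n t σ σ↭ n∸2≤2t x (L , y , R , π≡ , y<x) with All.all? (_<? x) L
... | yes L<x = L , y ∷ R , π≡ , L<x
... | no L≮x with find (¬All⇒Any¬ (_<? x) L L≮x)
...   | d , d∈L , d≮x = ⊥-elim (<⇒≱ (s≤s n∸2≤2t) (begin
  suc (t + t) ≤⟨ obstruction-bound n t σ σ↭ (subst (λ ℓ → Obstruction ℓ d x y) (sym π≡) ob) ⟩
  n ∸ x       ≤⟨ ∸-monoʳ-≤ n 2≤x ⟩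
  n ∸ 2       ∎))
  where
  open ≤-Reasoning
  u = subst Unique π≡ (iter-s-Unique σ (↭range⇒Unique n σ↭) t)
  x<d : x < d
  x<d = ≤∧≢⇒< (≮⇒≥ d≮x) (λ { refl → Unique-++⇒disjoint L u d∈L (here refl) })
  ob = adjacent-descent-obstruction L x y R u d∈L x<d y<x
  y∈π : y ∈ iter t s σ
  y∈π = subst (y ∈_) (sym π≡) (∈-++⁺ʳ L (there (here refl)))
  2≤x : 2 ≤ x
  2≤x = <-≤-trans (s≤s (∈range⇒1≤ n (∈iter⇒∈range n t σ↭ y∈π))) y<x

-- Fixed points at the end

withTail : List ℕ → ℕ → List ℕ
withTail X zero = X
withTail X (suc j) = withTail X j ++ [ suc (length (withTail X j)) ]

tl-snoc : ∀ π → tl (π ++ [ suc (length π) ]) ≡ suc (tl π)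
tl-snoc π rewrite length-++ π {[ suc (length π) ]} | +-comm (length π) 1
                | reverse-++ π [ suc (length π) ] | ≡ᵇ-refl (length π) = refl

tl-withTail : ∀ X j → j ≤ tl (withTail X j)
tl-withTail X zero = z≤n
tl-withTail X (suc j) rewrite tl-snoc (withTail X j) = s≤s (tl-withTail X j)

length-withTail : ∀ X j → length (withTail X j) ≡ length X + j
length-withTail X zero = sym (+-identityʳ _)
length-withTail X (suc j) = begin
  length (withTail X j ++ [ _ ]) ≡⟨ length-++ (withTail X j) ⟩
  length (withTail X j) + 1      ≡⟨ cong (_+ 1) (length-withTail X j) ⟩
  length X + j + 1               ≡⟨ +-assoc (length X) j 1 ⟩
  length X + (j + 1)             ≡⟨ cong (length X +_) (+-comm j 1) ⟩
  length X + suc j ∎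
  where open ≡-Reasoning

withTail-+ : ∀ W a b → withTail (withTail W a) b ≡ withTail W (a + b)
withTail-+ W a zero = cong (withTail W) (sym (+-identityʳ a))
withTail-+ W a (suc b) rewrite withTail-+ W a b | +-suc a b = refl

withTail-prefix : ∀ μ t → Σ (List ℕ) λ Y → withTail μ t ≡ μ ++ Y
withTail-prefix μ zero = [] , sym (++-identityʳ μ)
withTail-prefix μ (suc t) with withTail-prefix μ t
... | Y , e = Y ++ [ suc (length (withTail μ t)) ] , trans (cong (_++ [ suc (length (withTail μ t)) ]) e) (++-assoc μ Y _)

withTail-injective : ∀ {X X′} t → withTail X t ≡ withTail X′ t → X ≡ X′
withTail-injective zero e = e
withTail-injective {X} {X′} (suc t) e = withTail-injective t (∷ʳ-injectiveˡ (withTail X t) (withTail X′ t) e)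

withTail-↭ : ∀ {μ} k j → μ ↭ range k → withTail μ j ↭ range (k + j)
withTail-↭ {μ} k zero p = subst (λ z → μ ↭ range z) (sym (+-identityʳ k)) p
withTail-↭ {μ} k (suc j) p =
  subst (withTail μ (suc j) ↭_) (trans (sym (range-snoc (k + j))) (cong range (sym (+-suc k j))))
    (↭.++⁺ (withTail-↭ k j p) (subst (λ z → [ suc z ] ↭ [ suc (k + j) ]) (sym |μ+j|) ↭-refl))
  where
  |μ+j| : length (withTail μ j) ≡ k + j
  |μ+j| = trans (length-withTail μ j) (cong (_+ j) (↭range⇒length p))

Bounded : List ℕ → Set
Bounded ℓ = All (_≤ length ℓ) ℓ

↭range⇒Bounded : ∀ {X} n → X ↭ range n → Bounded X
↭range⇒Bounded n p =
  All.tabulate λ q → subst (_ ≤_) (sym (↭range⇒length p)) (∈range⇒≤ n (↭.∈-resp-↭ p q))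

Bounded-withTail : ∀ X j → Bounded X → Bounded (withTail X j)
Bounded-withTail X zero b = b
Bounded-withTail X (suc j) b =
  subst (λ k → All (_≤ k) (withTail X (suc j))) (sym (length-snoc (withTail X j) _))
        (All.++⁺ (All.map m≤n⇒m≤1+n (Bounded-withTail X j b)) (≤-refl ∷ []))

Sorts-withTail : ∀ {X πX} → Sorts X πX → Bounded X → ∀ j → Sorts (withTail X j) (withTail πX j)
Sorts-withTail sX b zero = sX
Sorts-withTail {X} {πX} sX b (suc j) rewrite sym (↭.↭-length (Sorts-↭ (Sorts-withTail sX b j))) =
  node {R = []} {πR = []} (Sorts-withTail sX b j) empty (All.map s≤s (Bounded-withTail X j b)) []

Sorts-last : ∀ {X πX} p → Sorts X πX → X ↭ range (suc p) →
             Σ (List ℕ) λ W → (πX ≡ W ++ [ suc p ]) × (W ↭ range p)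
Sorts-last p empty q = ⊥-elim (0≢1+n (↭range⇒length q))
Sorts-last p sX@(node {L} {R} {πL} {πR} {m} _ _ aL aR) q = πL ++ πR , πX≡ , W↭
  where
  m≤1+p : m ≤ suc p
  m≤1+p = ∈range⇒≤ (suc p) (↭.∈-resp-↭ q (∈-++⁺ʳ L (here refl)))
  1+p∈ : suc p ∈ L ++ m ∷ R
  1+p∈ = ↭.∈-resp-↭ (↭-sym q) (subst (suc p ∈_) (sym (range-snoc p)) (∈-++⁺ʳ (range p) (here refl)))
  m≡1+p : m ≡ suc p
  m≡1+p with ∈-++⁻ L 1+p∈
  ... | inj₁ q′ = ⊥-elim (<⇒≱ (All.lookup aL q′) m≤1+p)
  ... | inj₂ (here e) = sym e
  ... | inj₂ (there q′) = ⊥-elim (<⇒≱ (All.lookup aR q′) m≤1+p)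
  πX≡ : πL ++ πR ++ [ m ] ≡ (πL ++ πR) ++ [ suc p ]
  πX≡ = trans (cong (λ z → πL ++ πR ++ [ z ]) m≡1+p) (sym (++-assoc πL πR [ suc p ]))
  W↭ : πL ++ πR ↭ range p
  W↭ = ↭-drop-last (suc p) (subst₂ _↭_ πX≡ (range-snoc p) (↭-trans (↭-sym (Sorts-↭ sX)) q))

s-withTail : ∀ X p t → X ↭ range (suc p) →
             Σ (List ℕ) λ W → (s (withTail X t) ≡ withTail W (suc t)) × (W ↭ range p)
s-withTail X p t q = from-last (Sorts-last p sX q)
  where
  sX = Sorts-s X (↭range⇒Unique _ q)
  from-last : Σ (List ℕ) (λ W → (s X ≡ W ++ [ suc p ]) × (W ↭ range p)) →
              Σ (List ℕ) λ W → (s (withTail X t) ≡ withTail W (suc t)) × (W ↭ range p)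
  from-last (W , sX≡ , W↭) = W , eq , W↭
    where
    open ≡-Reasoning
    eq : s (withTail X t) ≡ withTail W (suc t)
    eq = begin
      s (withTail X t)               ≡⟨ s-Sorts (Sorts-withTail sX (↭range⇒Bounded _ q) t) ⟩
      withTail (s X) t               ≡⟨ cong (λ z → withTail z t) sX≡ ⟩
      withTail (W ++ [ suc p ]) t    ≡⟨ cong (λ z → withTail (W ++ [ suc z ]) t) (↭range⇒length W↭) ⟨
      withTail (withTail W 1) t      ≡⟨ withTail-+ W 1 t ⟩
      withTail W (suc t) ∎

iter-s-withTail : ∀ t n σ → t ≤ n → σ ↭ range n →
                  Σ (List ℕ) λ X → (iter t s σ ≡ withTail X t) × (X ↭ range (n ∸ t))
iter-s-withTail zero n σ _ p = σ , refl , p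
iter-s-withTail (suc t) n σ t<n p with iter-s-withTail t n σ (<⇒≤ t<n) p
... | X , π≡ , q with s-withTail X (n ∸ suc t) t (subst (λ k → X ↭ range k) (+-∸-assoc 1 t<n) q)
...   | W , sX≡ , W↭ = W , trans (cong s π≡) sX≡ , W↭

tlRev-head : ∀ r k → 1 ≤ tlRev k r → Σ (List ℕ) λ r′ → r ≡ k ∷ r′
tlRev-head (x ∷ r′) k h with x ≡ᵇ k in x≡ᵇk
... | true = r′ , cong (_∷ r′) (≡ᵇ⇒≡ x k (subst T (sym x≡ᵇk) _))

tl-unsnoc : ∀ π → 1 ≤ tl π → Σ (List ℕ) λ π′ → π ≡ π′ ++ [ suc (length π′) ]
tl-unsnoc π h with tlRev-head (reverse π) (length π) h
... | r′ , rev≡ = reverse r′ , trans π≡ (cong (λ z → reverse r′ ++ [ z ]) |π|≡)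
  where
  π≡ : π ≡ reverse r′ ++ [ length π ]
  π≡ = trans (sym (reverse-involutive π)) (trans (cong reverse rev≡) (unfold-reverse (length π) r′))
  |π|≡ : length π ≡ suc (length (reverse r′))
  |π|≡ = trans (cong length π≡) (length-snoc (reverse r′) _)

tl-withTail⁻ : ∀ t π n → π ↭ range n → t ≤ tl π →
               Σ (List ℕ) λ μ → (π ≡ withTail μ t) × (μ ↭ range (n ∸ t))
tl-withTail⁻ zero π n p _ = π , refl , p
tl-withTail⁻ (suc t) π n p h with tl-unsnoc π (≤-trans (s≤s z≤n) h)
... | π′ , refl = extend (tl-withTail⁻ t π′ (length π′) π′↭ (s≤s⁻¹ (subst (suc t ≤_) (tl-snoc π′) h)))
  where
  n≡ : n ≡ suc (length π′)
  n≡ = trans (sym (↭range⇒length p)) (length-snoc π′ _)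
  π′↭ : π′ ↭ range (length π′)
  π′↭ = ↭-drop-last (suc (length π′))
          (subst (π′ ++ [ suc (length π′) ] ↭_) (trans (cong range n≡) (range-snoc _)) p)
  extend : Σ (List ℕ) (λ μ → (π′ ≡ withTail μ t) × (μ ↭ range (length π′ ∸ t))) →
           Σ (List ℕ) λ μ → (π′ ++ [ suc (length π′) ] ≡ withTail μ (suc t)) × (μ ↭ range (n ∸ suc t))
  extend (μ , π′≡ , q) =
    μ , cong (λ z → z ++ [ suc (length z) ]) π′≡ , subst (λ k → μ ↭ range (k ∸ suc t)) (sym n≡) q

-- Permutations whose descent tops are left-to-right maxima

DescentTopsAreLRMax : List ℕ → Set
DescentTopsAreLRMax π = (x : ℕ) → IsDescentTop π x → IsLRMax π x

-- A left-to-right scan of DescentTopsAreLRMax; the index is the maximum of the part already read.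
RecordTops : ℕ → List ℕ → Set
RecordTops mx [] = ⊤
RecordTops mx (x ∷ []) = ⊤
RecordTops mx (x ∷ y ∷ r) = (y < x → mx < x) × RecordTops (mx ⊔ x) (y ∷ r)

RecordTops-tail : ∀ {mx x} r → RecordTops mx (x ∷ r) → RecordTops (mx ⊔ x) r
RecordTops-tail [] _ = _
RecordTops-tail (y ∷ r) (_ , p) = p

RecordTops-++⁻ˡ : ∀ {mx} A B → RecordTops mx (A ++ B) → RecordTops mx A
RecordTops-++⁻ˡ [] B p = _
RecordTops-++⁻ˡ (a ∷ []) B p = _
RecordTops-++⁻ˡ (a ∷ a′ ∷ A) B (f , p) = f , RecordTops-++⁻ˡ (a′ ∷ A) B p

++-cancel-at : ∀ {x : ℕ} L L′ {R R′} → L ++ x ∷ R ≡ L′ ++ x ∷ R′ → x ∉ L → x ∉ L′ → L ≡ L′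
++-cancel-at [] [] e _ _ = refl
++-cancel-at [] (l ∷ L′) refl _ x∉L′ = ⊥-elim (x∉L′ (here refl))
++-cancel-at (l ∷ L) [] refl x∉L _ = ⊥-elim (x∉L (here refl))
++-cancel-at (l ∷ L) (l′ ∷ L′) e x∉L x∉L′ with ∷-injective e
... | refl , e′ = cong (l ∷_) (++-cancel-at L L′ e′ (λ q → x∉L (there q)) (λ q → x∉L′ (there q)))

maxL-++ : ∀ A B → maxL (A ++ B) ≡ maxL A ⊔ maxL B
maxL-++ [] B = refl
maxL-++ (a ∷ A) B = trans (cong (a ⊔_) (maxL-++ A B)) (sym (⊔-assoc a (maxL A) (maxL B)))

maxL< : ∀ {x} L → All (_< x) L → 0 < x → maxL L < x
maxL< [] _ 0<x = 0<x
maxL< (l ∷ L) (l<x ∷ L<x) 0<x = ⊔-lub l<x (maxL< L L<x 0<x)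

RecordTops-suffix : ∀ L r → Unique (L ++ r) → DescentTopsAreLRMax (L ++ r) → RecordTops (maxL L) r
RecordTops-suffix L [] u p = _
RecordTops-suffix L (x ∷ []) u p = _
RecordTops-suffix L (x ∷ y ∷ r) u p =
  top , subst (λ z → RecordTops z (y ∷ r)) maxL-snoc
              (RecordTops-suffix (L ++ [ x ]) (y ∷ r) (subst Unique (sym ++-snoc) u)
                                 (subst DescentTopsAreLRMax (sym ++-snoc) p))
  where
  ++-snoc : (L ++ [ x ]) ++ y ∷ r ≡ L ++ x ∷ y ∷ r
  ++-snoc = ++-assoc L [ x ] (y ∷ r)
  maxL-snoc : maxL (L ++ [ x ]) ≡ maxL L ⊔ x
  maxL-snoc = trans (maxL-++ L [ x ]) (cong (maxL L ⊔_) (⊔-identityʳ x))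
  top : y < x → maxL L < x
  top y<x with p x (L , y , r , refl , y<x)
  ... | L′ , R′ , e , L′<x = maxL< L (subst (All (_< x)) (sym L≡L′) L′<x) (≤-<-trans z≤n y<x)
    where
    L≡L′ : L ≡ L′
    L≡L′ = ++-cancel-at L L′ e (λ q → Unique-++⇒disjoint L u q (here refl))
                              (λ q → <-irrefl refl (All.lookup L′<x q))

-- A block (M , A) is a left-to-right maximum M followed by the increasing run A of entries below M.
Blocks : Set
Blocks = List (ℕ × List ℕ)

flatten : Blocks → List ℕ
flatten [] = []
flatten ((M , A) ∷ bs) = M ∷ A ++ flatten bs

Increasing : List ℕ → Set
Increasing = AllPairs _<_

ValidBlocks : ℕ → Blocks → Set
ValidBlocks b [] = ⊤
ValidBlocks b ((M , A) ∷ bs) = b < M × Increasing A × All (_< M) A × ValidBlocks M bs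

HeadAbove : ℕ → List ℕ → Set
HeadAbove M l = ∀ {h r} → l ≡ h ∷ r → M < h

ValidBlocks-head : ∀ b bs → ValidBlocks b bs → HeadAbove b (flatten bs)
ValidBlocks-head b ((M , A) ∷ bs) (b<M , _) refl = b<M

split-below : ∀ x r → Σ (List ℕ) λ A → Σ (List ℕ) λ rest →
              (r ≡ A ++ rest) × All (_< x) A × (∀ {h r′} → rest ≡ h ∷ r′ → x ≤ h)
split-below x [] = [] , [] , refl , [] , λ ()
split-below x (h ∷ r) with h <? x
... | no h≮x = [] , h ∷ r , refl , [] , λ { refl → ≮⇒≥ h≮x }
... | yes h<x with split-below x r
...   | A , rest , r≡ , A<x , rest≥ = h ∷ A , rest , cong (h ∷_) r≡ , h<x ∷ A<x , rest≥

RecordTops-run : ∀ x A rest → Unique (A ++ rest) → All (_< x) A → RecordTops x (A ++ rest) →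
                 Increasing A × RecordTops x rest
RecordTops-run x [] rest u _ p = [] , p
RecordTops-run x (a ∷ A) rest (a∉ ∷ u) (a<x ∷ A<x) p
  with RecordTops-run x A rest u A<x
         (subst (λ z → RecordTops z (A ++ rest)) (m≥n⇒m⊔n≡m (<⇒≤ a<x)) (RecordTops-tail (A ++ rest) p))
... | incA , p-rest = a<A A incA p a∉ ∷ incA , p-rest
  where
  a<A : ∀ A′ → Increasing A′ → RecordTops x (a ∷ A′ ++ rest) → All (a ≢_) (A′ ++ rest) → All (a <_) A′
  a<A [] _ _ _ = []
  a<A (a′ ∷ A′) (a′<A′ ∷ _) (a-top , _) (a≢a′ ∷ _) = a<a′ ∷ All.map (<-trans a<a′) a′<A′
    where
    a<a′ : a < a′
    a<a′ = ≤∧≢⇒< (≮⇒≥ (λ a′<a → <-asym a<x (a-top a′<a))) a≢a′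

RecordTops⇒blocks : ∀ fuel ℓ mx → length ℓ ≤ fuel → Unique ℓ → RecordTops mx ℓ → HeadAbove mx ℓ →
                    Σ Blocks λ bs → ValidBlocks mx bs × flatten bs ≡ ℓ
RecordTops⇒blocks fuel [] mx _ _ _ _ = [] , _ , refl
RecordTops⇒blocks (suc fuel) (x ∷ r) mx (s≤s le) (x∉ ∷ u) p above with split-below x r
... | A , rest , refl , A<x , rest≥ with RecordTops-run x A rest u A<x
      (subst (λ z → RecordTops z (A ++ rest)) (m≤n⇒m⊔n≡n (<⇒≤ (above refl))) (RecordTops-tail (A ++ rest) p))
...   | incA , p-rest with RecordTops⇒blocks fuel rest x |rest|≤fuel (Unique-++⁻ʳ A u) p-rest rest>x
  where
  |rest|≤fuel = ≤-trans (subst (length rest ≤_) (sym (length-++ A)) (m≤n+m (length rest) (length A))) le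
  rest>x : HeadAbove x rest
  rest>x refl = ≤∧≢⇒< (rest≥ refl) (All.lookup x∉ (∈-++⁺ʳ A (here refl)))
...     | bs , v , flatten≡ = (x , A) ∷ bs , (above refl , incA , A<x , v) , cong (λ z → x ∷ A ++ z) flatten≡

-- Preimages of block forms

Sorts-++-increasing : ∀ {B π} A → Sorts B π → All (λ x → All (x <_) A) B → Increasing A →
                      Sorts (B ++ A) (π ++ A)
Sorts-++-increasing {B} {π} [] sB _ _ = subst₂ Sorts (sym (++-identityʳ B)) (sym (++-identityʳ π)) sB
Sorts-++-increasing {B} {π} (a ∷ A) sB B<aA (a<A ∷ incA) =
  subst₂ Sorts (++-assoc B [ a ] A) (++-assoc π [ a ] A)
    (Sorts-++-increasing A (node {R = []} {πR = []} sB empty (All.map All.head B<aA) [])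
       (All.++⁺ (All.map All.tail B<aA) (a<A ∷ [])) incA)

Sorts-increasing : ∀ A → Increasing A → Sorts A A
Sorts-increasing A incA = Sorts-++-increasing A empty [] incA

-- Each run moves one block to the right, behind the next maximum; K closes the last run.
shift-runs : List ℕ → Blocks → ℕ → Blocks
shift-runs A₀ [] K = [ K , A₀ ]
shift-runs A₀ ((M , A) ∷ bs) K = (M , A₀) ∷ shift-runs A bs K

Sorts-shift-runs : ∀ bs A₀ σ₀ π₀ b K → Sorts σ₀ π₀ → All (_≤ b) π₀ → All (_≤ b) A₀ → Increasing A₀ →
  ValidBlocks b bs → b < K → All (_< K) (flatten bs) →
  Sorts (σ₀ ++ flatten (shift-runs A₀ bs K)) (π₀ ++ A₀ ++ flatten bs ++ [ K ])
Sorts-shift-runs [] A₀ σ₀ π₀ b K sσ₀ π₀≤b A₀≤b incA₀ _ b<K _ =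
  subst (λ z → Sorts (σ₀ ++ K ∷ z) (π₀ ++ A₀ ++ [ K ])) (sym (++-identityʳ A₀))
    (node sσ₀ (Sorts-increasing A₀ incA₀)
          (All.tabulate (λ q → ≤-<-trans (All.lookup π₀≤b (↭.∈-resp-↭ (Sorts-↭ sσ₀) q)) b<K))
          (All.map (λ q → ≤-<-trans q b<K) A₀≤b))
Sorts-shift-runs ((M , A) ∷ bs) A₀ σ₀ π₀ b K sσ₀ π₀≤b A₀≤b incA₀ (b<M , incA , A<M , v) b<K bs<K =
  subst₂ Sorts (++-assoc σ₀ (M ∷ A₀) _) π≡
    (Sorts-shift-runs bs A (σ₀ ++ M ∷ A₀) (π₀ ++ A₀ ++ [ M ]) M K sσ₁ π₁≤M (All.map <⇒≤ A<M) incA v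
       (All.head bs<K) (All.++⁻ʳ A (All.tail bs<K)))
  where
  sσ₁ : Sorts (σ₀ ++ M ∷ A₀) (π₀ ++ A₀ ++ [ M ])
  sσ₁ = node sσ₀ (Sorts-increasing A₀ incA₀)
             (All.tabulate (λ q → ≤-<-trans (All.lookup π₀≤b (↭.∈-resp-↭ (Sorts-↭ sσ₀) q)) b<M))
             (All.map (λ q → ≤-<-trans q b<M) A₀≤b)
  π₁≤M : All (_≤ M) (π₀ ++ A₀ ++ [ M ])
  π₁≤M = All.++⁺ (All.map (λ q → <⇒≤ (≤-<-trans q b<M)) π₀≤b)
                 (All.++⁺ (All.map (λ q → <⇒≤ (≤-<-trans q b<M)) A₀≤b) (≤-refl ∷ []))
  π≡ : (π₀ ++ A₀ ++ [ M ]) ++ A ++ flatten bs ++ [ K ] ≡ π₀ ++ A₀ ++ (M ∷ A ++ flatten bs) ++ [ K ]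
  π≡ = begin
    (π₀ ++ A₀ ++ [ M ]) ++ A ++ flatten bs ++ [ K ]   ≡⟨ ++-assoc π₀ (A₀ ++ [ M ]) _ ⟩
    π₀ ++ (A₀ ++ [ M ]) ++ A ++ flatten bs ++ [ K ]   ≡⟨ cong (π₀ ++_) (++-assoc A₀ [ M ] _) ⟩
    π₀ ++ A₀ ++ M ∷ A ++ flatten bs ++ [ K ]
      ≡⟨ cong (λ z → π₀ ++ A₀ ++ M ∷ z) (++-assoc A (flatten bs) [ K ]) ⟨
    π₀ ++ A₀ ++ (M ∷ A ++ flatten bs) ++ [ K ] ∎
    where open ≡-Reasoning

ValidBlocks-shift-runs : ∀ bs A₀ c b K → c ≤ b → Increasing A₀ → All (_≤ b) A₀ → ValidBlocks b bs → b < K →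
                         All (_< K) (flatten bs) → ValidBlocks c (shift-runs A₀ bs K)
ValidBlocks-shift-runs [] A₀ c b K c≤b incA₀ A₀≤b _ b<K _ =
  ≤-<-trans c≤b b<K , incA₀ , All.map (λ q → ≤-<-trans q b<K) A₀≤b , _
ValidBlocks-shift-runs ((M , A) ∷ bs) A₀ c b K c≤b incA₀ A₀≤b (b<M , incA , A<M , v) b<K bs<K =
  ≤-<-trans c≤b b<M , incA₀ , All.map (λ q → ≤-<-trans q b<M) A₀≤b ,
  ValidBlocks-shift-runs bs A M M K ≤-refl incA (All.map <⇒≤ A<M) v (All.head bs<K) (All.++⁻ʳ A (All.tail bs<K))

block-preimage : ∀ k bs → ValidBlocks 0 bs → flatten bs ↭ range k →
  ValidBlocks 0 (shift-runs [] bs (suc k)) × (flatten (shift-runs [] bs (suc k)) ↭ range (suc k)) ×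
  Sorts (flatten (shift-runs [] bs (suc k))) (flatten bs ++ [ suc k ])
block-preimage k bs v p =
  v′ , ↭-trans (Sorts-↭ sσ) (subst (flatten bs ++ [ suc k ] ↭_) (sym (range-snoc k)) (↭.++⁺ p ↭-refl)) , sσ
  where
  bs<K = All.tabulate (λ q → s≤s (∈range⇒≤ k (↭.∈-resp-↭ p q)))
  v′ = ValidBlocks-shift-runs bs [] 0 0 (suc k) ≤-refl [] [] v (s≤s z≤n) bs<K
  sσ = Sorts-shift-runs bs [] [] [] 0 (suc k) empty [] [] [] v (s≤s z≤n) bs<K

withTail-in-image : ∀ t k bs j → ValidBlocks 0 bs → flatten bs ↭ range k → t ≤ j →
                    InImage (k + j) t (withTail (flatten bs) j)
withTail-in-image zero k bs j v p _ = withTail (flatten bs) j , withTail-↭ k j p , refl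
withTail-in-image (suc t) k bs (suc j) v p (s≤s t≤j) with block-preimage k bs v p
... | v′ , p′ , sσ with withTail-in-image t (suc k) (shift-runs [] bs (suc k)) j v′ p′ t≤j
...   | τ , τ↭ , τ≡ = τ , subst (λ z → τ ↭ range z) (sym (+-suc k j)) τ↭ , s-τ≡
  where
  open ≡-Reasoning
  s-τ≡ : s (iter t s τ) ≡ withTail (flatten bs) (suc j)
  s-τ≡ = begin
    s (iter t s τ)                              ≡⟨ cong s τ≡ ⟩
    s (withTail (flatten (shift-runs [] bs (suc k))) j) ≡⟨ s-Sorts (Sorts-withTail sσ (↭range⇒Bounded (suc k) p′) j) ⟩
    withTail (flatten bs ++ [ suc k ]) j        ≡⟨ cong (λ z → withTail (flatten bs ++ [ suc z ]) j) (↭range⇒length p) ⟨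
    withTail (withTail (flatten bs) 1) j        ≡⟨ withTail-+ (flatten bs) 1 j ⟩
    withTail (flatten bs) (suc j) ∎

InImage⇒↭range : ∀ n t {π} → InImage n t π → π ↭ range n
InImage⇒↭range n t (σ , σ↭ , refl) = ↭-trans (iter-s-↭ σ (↭range⇒Unique n σ↭) t) σ↭

InImage⇒tl : ∀ n t {π} → t ≤ n → InImage n t π → t ≤ tl π
InImage⇒tl n t t≤n (σ , σ↭ , refl) with iter-s-withTail t n σ t≤n σ↭
... | X , π≡ , _ = subst (λ π → t ≤ tl π) (sym π≡) (tl-withTail X t)

InImage⇒DescentTopsAreLRMax : ∀ n t {π} → n ∸ 2 ≤ t + t → InImage n t π → DescentTopsAreLRMax π
InImage⇒DescentTopsAreLRMax n t bound (σ , σ↭ , refl) = descent-top-isLRMax n t σ σ↭ bound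

blocks-of : ∀ {n t π} → π ↭ range n → t ≤ tl π → DescentTopsAreLRMax π →
            Σ Blocks λ bs → ValidBlocks 0 bs × (flatten bs ↭ range (n ∸ t)) × (π ≡ withTail (flatten bs) t)
blocks-of {n} {t} {π} π↭ t≤tl tops with tl-withTail⁻ t π n π↭ t≤tl
... | μ , refl , μ↭ with RecordTops⇒blocks (length μ) μ 0 ≤-refl uμ tops-μ μ>0
  where
  uπ = ↭range⇒Unique n π↭
  Y = proj₁ (withTail-prefix μ t)
  π≡ = proj₂ (withTail-prefix μ t)
  uμ = Unique-++⁻ˡ μ (subst Unique π≡ uπ)
  tops-μ = RecordTops-++⁻ˡ μ Y (subst (RecordTops 0) π≡ (RecordTops-suffix [] (withTail μ t) uπ tops))
  μ>0 : HeadAbove 0 μ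
  μ>0 refl = ∈range⇒1≤ (n ∸ t) (↭.∈-resp-↭ μ↭ (here refl))
... | bs , v , refl = bs , v , μ↭ , refl

DescentTopsAreLRMax⇒InImage : ∀ {n t π} → t ≤ n → π ↭ range n → t ≤ tl π → DescentTopsAreLRMax π →
                              InImage n t π
DescentTopsAreLRMax⇒InImage {n} {t} t≤n π↭ t≤tl tops with blocks-of π↭ t≤tl tops
... | bs , v , bs↭ , refl =
  subst (λ k → InImage k t _) (m∸n+n≡m t≤n) (withTail-in-image t (n ∸ t) bs t v bs↭ ≤-refl)

2m≤n+2⇒m≤n : ∀ m n → 1 ≤ n → 2 * m ≤ n + 2 → m ≤ n
2m≤n+2⇒m≤n m n 1≤n h with m ≤? n
... | yes m≤n = m≤n
... | no m≰n = ⊥-elim (<⇒≱ (m<m+n n 1≤n) (+-cancelˡ-≤ 2 (n + n) n (begin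
  2 + (n + n)    ≡⟨ cong suc (+-suc n n) ⟨
  suc n + suc n  ≤⟨ +-mono-≤ n<m n<m ⟩
  m + m          ≡⟨ cong (m +_) (+-identityʳ m) ⟨
  2 * m          ≤⟨ h ⟩
  n + 2          ≡⟨ +-comm n 2 ⟩
  2 + n          ∎)))
  where
  open ≤-Reasoning
  n<m = ≰⇒> m≰n

2m≤n+2⇒n∸2≤2[n∸m] : ∀ m n → m ≤ n → 2 * m ≤ n + 2 → n ∸ 2 ≤ (n ∸ m) + (n ∸ m)
2m≤n+2⇒n∸2≤2[n∸m] m n m≤n h = ∸-monoˡ-≤ 2 (begin
  n                 ≡⟨ m+[n∸m]≡n m≤n ⟨
  m + t             ≤⟨ +-monoˡ-≤ t m≤t+2 ⟩
  (t + 2) + t       ≡⟨ cong (_+ t) (+-comm t 2) ⟩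
  2 + (t + t)       ∎)
  where
  open ≤-Reasoning
  t = n ∸ m
  m≤t+2 : m ≤ t + 2
  m≤t+2 = +-cancelˡ-≤ m m (t + 2) (begin
    m + m           ≡⟨ cong (m +_) (+-identityʳ m) ⟨
    2 * m           ≤⟨ h ⟩
    n + 2           ≡⟨ cong (_+ 2) (m+[n∸m]≡n m≤n) ⟨
    m + t + 2       ≡⟨ +-assoc m t 2 ⟩
    m + (t + 2)     ∎)

module _ {A B : Set} where

  ∈-concatMap⁻′ : (f : A → List B) (L : List A) {z : B} → z ∈ concatMap f L → Σ A λ x → x ∈ L × z ∈ f x
  ∈-concatMap⁻′ f L q = find (∈-concatMap⁻ f q)

  ∈-concatMap⁺′ : (f : A → List B) {L : List A} {x : A} {z : B} → x ∈ L → z ∈ f x → z ∈ concatMap f L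
  ∈-concatMap⁺′ f x∈L z∈fx = ∈-concatMap⁺ f (Any.map (λ { refl → z∈fx }) x∈L)

  length-concatMap : (f : A → List B) (L : List A) → length (concatMap f L) ≡ sum (map (λ x → length (f x)) L)
  length-concatMap f [] = refl
  length-concatMap f (x ∷ L) = trans (length-++ (f x)) (cong (length (f x) +_) (length-concatMap f L))

  length-concatMap-const : (f : A → List B) (L : List A) (c : ℕ) → (∀ {x} → x ∈ L → length (f x) ≡ c) →
                           length (concatMap f L) ≡ c * length L
  length-concatMap-const f [] c h = sym (*-zeroʳ c)
  length-concatMap-const f (x ∷ L) c h =
    trans (length-++ (f x)) (trans (cong₂ _+_ (h (here refl)) (length-concatMap-const f L c (λ q → h (there q))))
                                   (sym (*-suc c (length L))))

  Unique-concatMap : (f : A → List B) (L : List A) → Unique L → (∀ {x} → x ∈ L → Unique (f x)) →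
    (∀ {x y} → x ∈ L → y ∈ L → x ≢ y → Disjoint (f x) (f y)) → Unique (concatMap f L)
  Unique-concatMap f [] _ _ _ = []
  Unique-concatMap f (x ∷ L) (x∉L ∷ u) uf disj =
    Unique.++⁺ (uf (here refl)) (Unique-concatMap f L u (λ q → uf (there q)) (λ p q → disj (there p) (there q)))
      λ (p , q) → let y , y∈L , z∈fy = ∈-concatMap⁻′ f L q in
                  disj (here refl) (there y∈L) (All.lookup x∉L y∈L) (p , z∈fy)

  Unique-map-injectiveOn : (f : A → B) (L : List A) → Unique L →
    (∀ {x y} → x ∈ L → y ∈ L → f x ≡ f y → x ≡ y) → Unique (map f L)
  Unique-map-injectiveOn f [] _ _ = []
  Unique-map-injectiveOn f (x ∷ L) (x∉L ∷ u) inj =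
    All.tabulate (λ q fx≡ → let y , y∈L , z≡fy = ∈-map⁻ f q in
                            All.lookup x∉L y∈L (inj (here refl) (there y∈L) (trans fx≡ z≡fy)))
    ∷ Unique-map-injectiveOn f L u (λ p q → inj (there p) (there q))

-- Enumerating block forms

shift : Blocks → Blocks
shift [] = []
shift ((M , A) ∷ bs) = (suc M , map suc A) ∷ shift bs

insert-1 : Blocks → List Blocks
insert-1 [] = []
insert-1 ((M , A) ∷ bs) = ((M , 1 ∷ A) ∷ bs) ∷ map ((M , A) ∷_) (insert-1 bs)

-- The entry 1 is a singleton block (necessarily the first) or joins one of the k+1 blocks,
-- which is the recurrence S(m+1,k+1) = S(m,k) + (k+1) S(m,k+1).
add-singleton-1 : Blocks → Blocks
add-singleton-1 bs = (1 , []) ∷ shift bs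

join-1 : Blocks → List Blocks
join-1 bs = insert-1 (shift bs)

blockForms : ℕ → ℕ → List Blocks
blockForms zero zero = [ [] ]
blockForms zero (suc k) = []
blockForms (suc m) zero = []
blockForms (suc m) (suc k) =
  map add-singleton-1 (blockForms m k) ++ concatMap join-1 (blockForms m (suc k))

length-shift : ∀ bs → length (shift bs) ≡ length bs
length-shift [] = refl
length-shift (b ∷ bs) = cong suc (length-shift bs)

flatten-shift : ∀ bs → flatten (shift bs) ≡ map suc (flatten bs)
flatten-shift [] = refl
flatten-shift ((M , A) ∷ bs) =
  cong (suc M ∷_) (trans (cong (map suc A ++_) (flatten-shift bs)) (sym (map-++ suc A (flatten bs))))

shift-injective : ∀ {x y} → shift x ≡ shift y → x ≡ y
shift-injective {[]} {[]} e = refl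
shift-injective {(M , A) ∷ x} {(M′ , A′) ∷ y} e with ∷-injective e
... | e₁ , e₂ with ×-≡,≡←≡ e₁
...   | eM , eA = cong₂ _∷_ (cong₂ _,_ (suc-injective eM) (map-injective suc-injective eA)) (shift-injective e₂)

ValidBlocks-shift : ∀ b bs → ValidBlocks b bs → ValidBlocks (suc b) (shift bs)
ValidBlocks-shift b [] v = _
ValidBlocks-shift b ((M , A) ∷ bs) (b<M , incA , A<M , v) =
  s≤s b<M , AllPairs.map⁺ (AllPairs.map s≤s incA) , All.map⁺ (All.map s≤s A<M) , ValidBlocks-shift M bs v

ValidBlocks-weaken : ∀ {b′ b} → b′ ≤ b → ∀ bs → ValidBlocks b bs → ValidBlocks b′ bs
ValidBlocks-weaken b′≤b [] _ = _
ValidBlocks-weaken b′≤b ((M , A) ∷ bs) (b<M , rest) = ≤-<-trans b′≤b b<M , rest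

ValidBlocks-unshift : ∀ b bs → ValidBlocks (suc b) (shift bs) → ValidBlocks b bs
ValidBlocks-unshift b [] v = _
ValidBlocks-unshift b ((M , A) ∷ bs) (b<M , incA , A<M , v) =
  s≤s⁻¹ b<M , AllPairs.map s≤s⁻¹ (AllPairs.map⁻ incA) , All.map s≤s⁻¹ (All.map⁻ A<M) , ValidBlocks-unshift M bs v

shift-↭ : ∀ {bs m} → flatten bs ↭ range m → 1 ∷ flatten (shift bs) ↭ range (suc m)
shift-↭ {bs} {m} p =
  subst₂ (λ xs ys → 1 ∷ xs ↭ ys) (sym (flatten-shift bs)) (sym (range-cons m)) (prep 1 (↭.map⁺ suc p))

length-insert-1 : ∀ bs → length (insert-1 bs) ≡ length bs
length-insert-1 [] = refl
length-insert-1 ((M , A) ∷ bs) = cong suc (trans (length-map _ (insert-1 bs)) (length-insert-1 bs))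

insert-1-length : ∀ bs {z} → z ∈ insert-1 bs → length z ≡ length bs
insert-1-length ((M , A) ∷ bs) (here refl) = refl
insert-1-length ((M , A) ∷ bs) (there q) with ∈-map⁻ ((M , A) ∷_) q
... | z′ , z′∈ , refl = cong suc (insert-1-length bs z′∈)

insert-1-↭ : ∀ bs {z} → z ∈ insert-1 bs → flatten z ↭ 1 ∷ flatten bs
insert-1-↭ ((M , A) ∷ bs) (here refl) = swap M 1 ↭-refl
insert-1-↭ ((M , A) ∷ bs) (there q) with ∈-map⁻ ((M , A) ∷_) q
... | z′ , z′∈ , refl =
  ↭-trans (prep M (↭.++⁺ˡ A (insert-1-↭ bs z′∈)))
          (↭-trans (prep M (↭.shift 1 A (flatten bs))) (swap M 1 ↭-refl))

insert-1-valid : ∀ b bs → ValidBlocks b bs → All (1 <_) (flatten bs) →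
                 ∀ {z} → z ∈ insert-1 bs → ValidBlocks b z
insert-1-valid b ((M , A) ∷ bs) (b<M , incA , A<M , v) 1< (here refl) =
  b<M , (All.++⁻ˡ A (All.tail 1<) ∷ incA) , (All.head 1< ∷ A<M) , v
insert-1-valid b ((M , A) ∷ bs) (b<M , incA , A<M , v) 1< (there q) with ∈-map⁻ ((M , A) ∷_) q
... | z′ , z′∈ , refl = b<M , incA , A<M , insert-1-valid M bs v (All.++⁻ʳ A (All.tail 1<)) z′∈

Unique-insert-1 : ∀ bs → Unique (insert-1 bs)
Unique-insert-1 [] = []
Unique-insert-1 ((M , A) ∷ bs) =
  All.tabulate first-is-new
  ∷ Unique-map-injectiveOn ((M , A) ∷_) (insert-1 bs) (Unique-insert-1 bs) (λ _ _ e → proj₂ (∷-injective e))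
  where
  first-is-new : ∀ {z} → z ∈ map ((M , A) ∷_) (insert-1 bs) → (M , 1 ∷ A) ∷ bs ≢ z
  first-is-new q e with ∈-map⁻ ((M , A) ∷_) q
  ... | _ , _ , refl = <-irrefl (sym (cong length (proj₂ (×-≡,≡←≡ (proj₁ (∷-injective e)))))) (n<1+n (length A))

delete-1 : Blocks → Blocks
delete-1 [] = []
delete-1 ((M , suc zero ∷ A) ∷ bs) = (M , A) ∷ bs
delete-1 (b ∷ bs) = b ∷ delete-1 bs

delete-1-insert-1 : ∀ bs → All (2 ≤_) (flatten bs) → ∀ {z} → z ∈ insert-1 bs → delete-1 z ≡ bs
delete-1-insert-1 ((M , A) ∷ bs) _ (here refl) = refl
delete-1-insert-1 ((M , A) ∷ bs) 2≤ (there q) with ∈-map⁻ ((M , A) ∷_) q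
... | z′ , z′∈ , refl with A | 2≤
...   | [] | _ ∷ 2≤bs = cong ((M , []) ∷_) (delete-1-insert-1 bs 2≤bs z′∈)
...   | suc (suc a) ∷ A′ | _ ∷ _ ∷ 2≤A′bs =
  cong ((M , suc (suc a) ∷ A′) ∷_) (delete-1-insert-1 bs (All.++⁻ʳ A′ 2≤A′bs) z′∈)
...   | suc zero ∷ A′ | _ ∷ (s≤s () ∷ _)

blockForms-sound : ∀ m k {bs} → bs ∈ blockForms m k →
                   ValidBlocks 0 bs × (flatten bs ↭ range m) × (length bs ≡ k)
blockForms-sound zero zero (here refl) = _ , ↭-refl , refl
blockForms-sound (suc m) (suc k) {bs} q with ∈-++⁻ (map add-singleton-1 (blockForms m k)) q
... | inj₁ q₁ with ∈-map⁻ add-singleton-1 q₁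
...   | bs′ , bs′∈ , refl with blockForms-sound m k bs′∈
...     | v , p , len =
  (s≤s z≤n , [] , [] , ValidBlocks-shift 0 bs′ v) , shift-↭ p , cong suc (trans (length-shift bs′) len)
blockForms-sound (suc m) (suc k) q | inj₂ q₂ with ∈-concatMap⁻′ join-1 (blockForms m (suc k)) q₂
... | bs′ , bs′∈ , bs∈ with blockForms-sound m (suc k) bs′∈
...   | v , p , len =
  insert-1-valid 0 (shift bs′) (ValidBlocks-weaken z≤n (shift bs′) (ValidBlocks-shift 0 bs′ v)) 1<shift bs∈ ,
  ↭-trans (insert-1-↭ (shift bs′) bs∈) (shift-↭ p) ,
  trans (insert-1-length (shift bs′) bs∈) (trans (length-shift bs′) len)
  where
  1<shift : All (1 <_) (flatten (shift bs′))
  1<shift = subst (All (1 <_)) (sym (flatten-shift bs′))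
                  (All.map⁺ (All.tabulate (λ q → s≤s (∈range⇒1≤ m (↭.∈-resp-↭ p q)))))

length-blockForms : ∀ m k → length (blockForms m k) ≡ stirling2 m k
length-blockForms zero zero = refl
length-blockForms zero (suc k) = refl
length-blockForms (suc m) zero = refl
length-blockForms (suc m) (suc k) = begin
  length (map add-singleton-1 (blockForms m k) ++ concatMap join-1 (blockForms m (suc k)))
    ≡⟨ length-++ (map add-singleton-1 (blockForms m k)) ⟩
  length (map add-singleton-1 (blockForms m k)) + length (concatMap join-1 (blockForms m (suc k)))
    ≡⟨ cong₂ _+_ (length-map _ (blockForms m k))
                 (length-concatMap-const _ (blockForms m (suc k)) (suc k) length-join-1) ⟩
  length (blockForms m k) + suc k * length (blockForms m (suc k))
    ≡⟨ cong₂ (λ a b → a + suc k * b) (length-blockForms m k) (length-blockForms m (suc k)) ⟩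
  stirling2 m k + suc k * stirling2 m (suc k)
    ≡⟨ +-comm (stirling2 m k) _ ⟩
  stirling2 (suc m) (suc k) ∎
  where
  open ≡-Reasoning
  length-join-1 : ∀ {bs} → bs ∈ blockForms m (suc k) → length (join-1 bs) ≡ suc k
  length-join-1 {bs} q =
    trans (length-insert-1 (shift bs)) (trans (length-shift bs) (proj₂ (proj₂ (blockForms-sound m (suc k) q))))

Unique-blockForms : ∀ m k → Unique (blockForms m k)
Unique-blockForms zero zero = [] ∷ []
Unique-blockForms zero (suc k) = []
Unique-blockForms (suc m) zero = []
Unique-blockForms (suc m) (suc k) = Unique.++⁺ singletons joined disjoint
  where
  singletons = Unique-map-injectiveOn add-singleton-1 (blockForms m k) (Unique-blockForms m k)
                 (λ _ _ e → shift-injective (proj₂ (∷-injective e)))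
  2≤shift : ∀ {bs} → bs ∈ blockForms m (suc k) → All (2 ≤_) (flatten (shift bs))
  2≤shift {bs} q = subst (All (2 ≤_)) (sym (flatten-shift bs))
    (All.map⁺ (All.tabulate (λ r → s≤s (∈range⇒1≤ m (↭.∈-resp-↭ (proj₁ (proj₂ (blockForms-sound m (suc k) q))) r)))))
  joined = Unique-concatMap join-1 (blockForms m (suc k)) (Unique-blockForms m (suc k)) (λ _ → Unique-insert-1 _)
             (λ {x} {y} x∈ y∈ x≢y (p , q) →
                x≢y (shift-injective (trans (sym (delete-1-insert-1 (shift x) (2≤shift x∈) p))
                                            (delete-1-insert-1 (shift y) (2≤shift y∈) q))))
  first-maximum-of-joined : ∀ bs {z} → ValidBlocks 0 bs → z ∈ join-1 bs →
                            Σ ℕ λ M → Σ (List ℕ) λ A → Σ Blocks λ r → (z ≡ (M , A) ∷ r) × 1 < M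
  first-maximum-of-joined ((M , A) ∷ bs) (0<M , _) (here refl) = suc M , 1 ∷ map suc A , shift bs , refl , s≤s 0<M
  first-maximum-of-joined ((M , A) ∷ bs) (0<M , _) (there q) with ∈-map⁻ ((suc M , map suc A) ∷_) q
  ... | z′ , _ , refl = suc M , map suc A , z′ , refl , s≤s 0<M
  disjoint : Disjoint (map add-singleton-1 (blockForms m k)) (concatMap join-1 (blockForms m (suc k)))
  disjoint (p , q) with ∈-map⁻ add-singleton-1 p | ∈-concatMap⁻′ join-1 (blockForms m (suc k)) q
  ... | _ , _ , refl | y , y∈ , z∈ with first-maximum-of-joined y (proj₁ (blockForms-sound m (suc k) y∈)) z∈
  ...   | M , A , r , e , 1<M = <-irrefl (cong proj₁ (proj₁ (∷-injective e))) 1<M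

↭-map-suc⁻ : ∀ {X Y} → map suc X ↭ map suc Y → X ↭ Y
↭-map-suc⁻ {X} {Y} p = subst₂ _↭_ (pred-suc X) (pred-suc Y) (↭.map⁺ pred p)
  where
  pred-suc : ∀ Z → map pred (map suc Z) ≡ Z
  pred-suc Z = trans (sym (map-∘ Z)) (map-id Z)

unshift : Blocks → Blocks
unshift [] = []
unshift ((M , A) ∷ bs) = (pred M , map pred A) ∷ unshift bs

shift-unshift : ∀ bs → All (1 ≤_) (flatten bs) → shift (unshift bs) ≡ bs
shift-unshift [] _ = refl
shift-unshift ((suc M , A) ∷ bs) (_ ∷ pos) =
  cong₂ _∷_ (cong (suc M ,_) (trans (sym (map-∘ A)) (map-id-local (All.map suc-pred-1≤ (All.++⁻ˡ A pos)))))
            (shift-unshift bs (All.++⁻ʳ A pos))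
  where
  suc-pred-1≤ : ∀ {n} → 1 ≤ n → suc (pred n) ≡ n
  suc-pred-1≤ (s≤s z≤n) = refl

unshift-blocks : ∀ m bs → ValidBlocks 1 bs → 1 ∷ flatten bs ↭ range (suc m) →
                 Σ Blocks λ bs′ → (shift bs′ ≡ bs) × ValidBlocks 0 bs′ × (flatten bs′ ↭ range m)
unshift-blocks m bs v p = unshift bs , shift-unshift bs 1≤bs , v′ , p′
  where
  1∉bs : All (1 ≢_) (flatten bs)
  1∉bs = AllPairs.head (↭range⇒Unique (suc m) p)
  1≤bs : All (1 ≤_) (flatten bs)
  1≤bs = All.tabulate λ q → ∈range⇒1≤ (suc m) (↭.∈-resp-↭ p (there q))
  bs≡ = shift-unshift bs 1≤bs
  v′ : ValidBlocks 0 (unshift bs)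
  v′ = ValidBlocks-unshift 0 (unshift bs) (subst (ValidBlocks 1) (sym bs≡) v)
  p′ : flatten (unshift bs) ↭ range m
  p′ = ↭-map-suc⁻ (↭.drop-∷ (subst₂ (λ xs ys → 1 ∷ xs ↭ ys) (trans (cong flatten (sym bs≡)) (flatten-shift _))
                                    (range-cons m) p))

increasing-1∈ : ∀ {A} → Increasing A → All (1 ≤_) A → 1 ∈ A → Σ (List ℕ) λ A′ → A ≡ 1 ∷ A′
increasing-1∈ {_ ∷ A′} _ _ (here refl) = A′ , refl
increasing-1∈ (a<A ∷ _) (1≤a ∷ _) (there 1∈A) = ⊥-elim (<⇒≱ (All.lookup a<A 1∈A) 1≤a)

remove-1 : ∀ {b} bs → 1 ≤ b → ValidBlocks b bs → All (1 ≤_) (flatten bs) → 1 ∈ flatten bs →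
           Σ Blocks λ bs′ → (bs ∈ insert-1 bs′) × ValidBlocks b bs′
remove-1 ((M , A) ∷ bs) 1≤b (b<M , _) _ (here refl) = ⊥-elim (<⇒≱ b<M 1≤b)
remove-1 ((M , A) ∷ bs) 1≤b (b<M , incA , A<M , v) (_ ∷ pos) (there q) with ∈-++⁻ A q
... | inj₁ 1∈A with increasing-1∈ incA (All.++⁻ˡ A pos) 1∈A
...   | A′ , refl = (M , A′) ∷ bs , here refl , b<M , AllPairs.tail incA , All.tail A<M , v
remove-1 ((M , A) ∷ bs) 1≤b (b<M , incA , A<M , v) (_ ∷ pos) (there q) | inj₂ 1∈bs
  with remove-1 bs (<⇒≤ (≤-<-trans 1≤b b<M)) v (All.++⁻ʳ A pos) 1∈bs
... | bs′ , bs∈ , v′ = (M , A) ∷ bs′ , there (∈-map⁺ ((M , A) ∷_) bs∈) , b<M , incA , A<M , v′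

data Split-1 (m : ℕ) : Blocks → Set where
  singleton : ∀ {bs′} → ValidBlocks 0 bs′ → flatten bs′ ↭ range m → Split-1 m ((1 , []) ∷ shift bs′)
  joined    : ∀ {bs bs′} → ValidBlocks 0 bs′ → flatten bs′ ↭ range m → bs ∈ insert-1 (shift bs′) → Split-1 m bs

split-1 : ∀ m bs → ValidBlocks 0 bs → flatten bs ↭ range (suc m) → Split-1 m bs
split-1 m [] _ p = ⊥-elim (0≢1+n (↭range⇒length p))
split-1 m ((M , A) ∷ bs) (0<M , incA , A<M , v₀) p with M ≟ 1
split-1 m ((1 , []) ∷ bs) (_ , _ , _ , v₀) p | yes refl with unshift-blocks m bs v₀ p
... | bs′ , refl , v′ , p′ = singleton v′ p′
split-1 m ((1 , a ∷ A) ∷ bs) (_ , _ , a<1 ∷ _ , _) p | yes refl =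
  ⊥-elim (<⇒≱ a<1 (∈range⇒1≤ (suc m) (↭.∈-resp-↭ p (there (here refl)))))
split-1 m ((M , A) ∷ bs) (0<M , incA , A<M , v₀) p | no M≢1
  with remove-1 ((M , A) ∷ bs) ≤-refl (1<M , incA , A<M , v₀) 1≤bs
                (↭.∈-resp-↭ (↭-sym p) (subst (1 ∈_) (sym (range-cons m)) (here refl)))
  where
  1<M = ≤∧≢⇒< 0<M (≢-sym M≢1)
  1≤bs = All.tabulate λ q → ∈range⇒1≤ (suc m) (↭.∈-resp-↭ p q)
... | bs₁ , bs∈ , v₁ with unshift-blocks m bs₁ v₁ (↭-trans (↭-sym (insert-1-↭ bs₁ bs∈)) p)
...   | bs′ , refl , v′ , p′ = joined v′ p′ bs∈

flatten≡[] : ∀ bs → flatten bs ≡ [] → bs ≡ []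
flatten≡[] [] _ = refl

blockForms-complete : ∀ m bs → ValidBlocks 0 bs → flatten bs ↭ range m → bs ∈ blockForms m (length bs)
blockForms-complete zero bs v p rewrite flatten≡[] bs (↭.↭-empty-inv p) = here refl
blockForms-complete (suc m) bs v p with split-1 m bs v p
... | singleton {bs′} v′ p′ =
  ∈-++⁺ˡ (∈-map⁺ add-singleton-1
    (subst (λ k → bs′ ∈ blockForms m k) (sym (length-shift bs′)) (blockForms-complete m bs′ v′ p′)))
... | joined {bs′ = b ∷ bs″} v′ p′ bs∈ rewrite insert-1-length (shift (b ∷ bs″)) bs∈ | length-shift bs″ =
  ∈-++⁺ʳ (map add-singleton-1 (blockForms m (length bs″)))
         (∈-concatMap⁺′ join-1 (blockForms-complete m (b ∷ bs″) v′ p′) bs∈)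

allBlockForms : ℕ → List Blocks
allBlockForms m = concatMap (blockForms m) (upTo (suc m))

length-allBlockForms : ∀ m → length (allBlockForms m) ≡ bell m
length-allBlockForms m =
  trans (length-concatMap (blockForms m) (upTo (suc m))) (cong sum (map-cong (length-blockForms m) (upTo (suc m))))

allBlockForms-sound : ∀ m {bs} → bs ∈ allBlockForms m → ValidBlocks 0 bs × (flatten bs ↭ range m)
allBlockForms-sound m q with ∈-concatMap⁻′ (blockForms m) (upTo (suc m)) q
... | k , _ , bs∈ with blockForms-sound m k bs∈
...   | v , p , _ = v , p

length≤length-flatten : ∀ bs → length bs ≤ length (flatten bs)
length≤length-flatten [] = z≤n
length≤length-flatten ((M , A) ∷ bs) =
  s≤s (≤-trans (length≤length-flatten bs) (subst (length (flatten bs) ≤_) (sym (length-++ A)) (m≤n+m _ (length A))))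

allBlockForms-complete : ∀ m bs → ValidBlocks 0 bs → flatten bs ↭ range m → bs ∈ allBlockForms m
allBlockForms-complete m bs v p =
  ∈-concatMap⁺′ (blockForms m) (∈-upTo⁺ (s≤s (≤-trans (length≤length-flatten bs) (≤-reflexive (↭range⇒length p)))))
                (blockForms-complete m bs v p)

Unique-allBlockForms : ∀ m → Unique (allBlockForms m)
Unique-allBlockForms m =
  Unique-concatMap (blockForms m) (upTo (suc m)) (Unique.upTo⁺ (suc m)) (λ _ → Unique-blockForms m _)
    (λ {k} {k′} _ _ k≢k′ (p , q) → k≢k′ (trans (sym (proj₂ (proj₂ (blockForms-sound m k p))))
                                               (proj₂ (proj₂ (blockForms-sound m k′ q)))))

++-cancel-below : ∀ {M} A A′ r r′ → All (_< M) A → All (_< M) A′ → HeadAbove M r → HeadAbove M r′ →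
                  A ++ r ≡ A′ ++ r′ → A ≡ A′ × r ≡ r′
++-cancel-below [] [] r r′ _ _ _ _ e = refl , e
++-cancel-below [] (a′ ∷ A′) r r′ _ (a′<M ∷ _) r>M _ e = ⊥-elim (<-asym a′<M (r>M e))
++-cancel-below (a ∷ A) [] r r′ (a<M ∷ _) _ _ r′>M e = ⊥-elim (<-asym a<M (r′>M (sym e)))
++-cancel-below (a ∷ A) (a′ ∷ A′) r r′ (_ ∷ A<M) (_ ∷ A′<M) r>M r′>M e with ∷-injective e
... | refl , e′ with ++-cancel-below A A′ r r′ A<M A′<M r>M r′>M e′
...   | refl , r≡r′ = refl , r≡r′

flatten-injective : ∀ b x y → ValidBlocks b x → ValidBlocks b y → flatten x ≡ flatten y → x ≡ y
flatten-injective b [] [] _ _ _ = refl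
flatten-injective b ((M , A) ∷ x) ((M′ , A′) ∷ y) (_ , _ , A<M , vx) (_ , _ , A′<M′ , vy) e with ∷-injective e
... | refl , e′
  with ++-cancel-below A A′ (flatten x) (flatten y) A<M A′<M′ (ValidBlocks-head M x vx) (ValidBlocks-head M y vy) e′
...   | refl , e″ = cong ((M , A) ∷_) (flatten-injective M x y vx vy e″)

image-enumeration : ∀ m n → m ≤ n → n ∸ 2 ≤ (n ∸ m) + (n ∸ m) →
  Σ (List (List ℕ)) λ xs → Unique xs × ((π : List ℕ) → (π ∈ xs ⇔ InImage n (n ∸ m) π)) × (length xs ≡ bell m)
image-enumeration m n m≤n bound = map F (allBlockForms m) , unique , (λ π → mk⇔ (to π) (from π)) ,
  trans (length-map F (allBlockForms m)) (length-allBlockForms m)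
  where
  t = n ∸ m
  F : Blocks → List ℕ
  F bs = withTail (flatten bs) t
  unique = Unique-map-injectiveOn F (allBlockForms m) (Unique-allBlockForms m)
    λ x∈ y∈ e → flatten-injective 0 _ _ (proj₁ (allBlockForms-sound m x∈)) (proj₁ (allBlockForms-sound m y∈))
                                      (withTail-injective t e)
  to : ∀ π → π ∈ map F (allBlockForms m) → InImage n t π
  to π q with ∈-map⁻ F q
  ... | bs , bs∈ , refl with allBlockForms-sound m bs∈
  ...   | v , p = subst (λ k → InImage k t (F bs)) (m+[n∸m]≡n m≤n) (withTail-in-image t m bs t v p ≤-refl)
  from : ∀ π → InImage n t π → π ∈ map F (allBlockForms m)
  from π im
    with blocks-of (InImage⇒↭range n t im) (InImage⇒tl n t (m∸n≤m n m) im) (InImage⇒DescentTopsAreLRMax n t bound im)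
  ... | bs , v , p , refl =
    ∈-map⁺ F (allBlockForms-complete m bs v (subst (λ k → flatten bs ↭ range k) (m∸[m∸n]≡n m≤n) p))

theorem1p1 : (m n : ℕ) → 1 ≤ m → 1 ≤ n → 2 * m ≤ n + 2 →
    ((π : List ℕ) → IsPerm n π →
      (InImage n (n ∸ m) π ⇔
        ((n ∸ m ≤ tl π) × ((x : ℕ) → IsDescentTop π x → IsLRMax π x))))
    × Σ (List (List ℕ)) (λ xs → Unique xs
        × ((π : List ℕ) → (π ∈ xs ⇔ InImage n (n ∸ m) π))
        × (length xs ≡ bell m))
theorem1p1 m n _ 1≤n 2m≤n+2 = characterization , image-enumeration m n m≤n bound
  where
  m≤n = 2m≤n+2⇒m≤n m n 1≤n 2m≤n+2
  bound = 2m≤n+2⇒n∸2≤2[n∸m] m n m≤n 2m≤n+2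
  t≤n = m∸n≤m n m
  characterization : (π : List ℕ) → IsPerm n π →
    InImage n (n ∸ m) π ⇔ ((n ∸ m ≤ tl π) × DescentTopsAreLRMax π)
  characterization π π↭ =
    mk⇔ (λ im → InImage⇒tl n (n ∸ m) t≤n im , InImage⇒DescentTopsAreLRMax n (n ∸ m) bound im)
        (λ (t≤tl , tops) → DescentTopsAreLRMax⇒InImage t≤n π↭ t≤tl tops)
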